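{- Let $q$ be a prime power, let $S$ be a set of $q+1$ points in $PG(2,q)$, and let $A\subseteq S$ be an $S$-maximal $k$-arc. Let $B$ be a pro-arc set of size $l$ with respect to $S$ and $A$, where $0\le l\le q+1-k$. Let $u_0(S)$ be the number of lines of $PG(2,q)$ disjoint from $S$. Then: (1) If for each point $P\in S\setminus A$ there are at most $\lambda$ tangent lines to $A$ through $P$, where $\lambda\le k$, then $u_0(S)\le \frac{q(q-1)}{2}-(q+1-k)\frac{k-\lambda}{2}$. (2) $u_0(S)\le \frac{q(q-1)}{2}-2(q+1)+2k+l$.
   Context: A $k$-arc is a set of $k$ points of $PG(2,q)$ no three collinear. A line is a tangent line to a point set $D$ if it meets $D$ in exactly one point, and a $2$-secant line to $D$ if it meets $D$ in exactly two points. For a point set $S$, a subset $A\subseteq S$ is an $S$-maximal arc if $A$ is an arc and for every $P\in S\setminus A$ the set $A\cup\{P\}$ is not an arc. A point $P\in S\setminus A$ is a pro-arc point of $A$ if there is exactly one $2$-secant line to $A$ through $P$. A pro-arc set with respect to $S$ and $A$ is a set $B$ such that (a) $B$ is contained in the set of pro-arc points of $A$ lying in $S\setminus A$, and (b) for each $2$-secant line $\ell$ to $A$ which contains a pro-arc point of $A$ (in $S\setminus A$), $|B\cap\ell|=1$. -}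

module Defs where

open import Data.Nat using (ℕ; zero; suc; _+_)
open import Data.Fin using (Fin; _≟_)
open import Data.Fin.Properties using () renaming (_≟_ to _≟F_)
open import Data.Bool using (Bool; true; false; _∧_; _∨_; if_then_else_)
open import Data.List using (List; []; _∷_; map; concatMap)
open import Data.List using () renaming (allFin to allFinL)
open import Data.Product using (Σ; _×_; _,_)
open import Relation.Nullary using (¬_; Dec; yes; no; does)
open import Relation.Binary.PropositionalEquality using (_≡_; _≢_; refl; cong; cong₂)
open import Algebra.Structures using (IsCommutativeRing)

-- A finite field with q elements, carrier Fin q, with propositional equality.
-- (Every finite field has prime-power order and every prime power occurs,
-- so "PG(2,q), q a prime power" = "PG(2,F) for a field F on Fin q".)
record FiniteField (q : ℕ) : Set where
  field
    _+F_ _*F_ : Fin q → Fin q → Fin q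
    -F_ : Fin q → Fin q
    0F 1F : Fin q
    isCommutativeRing : IsCommutativeRing _≡_ _+F_ _*F_ -F_ 0F 1F
    0≢1 : 0F ≢ 1F
    inverse : ∀ x → x ≢ 0F → Σ (Fin q) λ y → x *F y ≡ 1F

count : {X : Set} → (X → Bool) → List X → ℕ
count p [] = 0
count p (x ∷ xs) = if p x then suc (count p xs) else count p xs

_≡ᵇ_ : ℕ → ℕ → Bool
zero ≡ᵇ zero = true
zero ≡ᵇ suc n = false
suc m ≡ᵇ zero = false
suc m ≡ᵇ suc n = m ≡ᵇ n

module PG {q : ℕ} (F : FiniteField q) where
  open FiniteField F

  -- Points of PG(2,q) as normalised homogeneous coordinates:
  -- pt1 y z = (1:y:z), pt2 z = (0:1:z), pt3 = (0:0:1).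
  data Point : Set where
    pt1 : Fin q → Fin q → Point
    pt2 : Fin q → Point
    pt3 : Point

  -- Lines of PG(2,q), normalised dual coordinates [a:b:c] in the same way.
  Line : Set
  Line = Point

  coords : Point → Fin q × Fin q × Fin q
  coords (pt1 y z) = 1F , y , z
  coords (pt2 z) = 0F , 1F , z
  coords pt3 = 0F , 0F , 1F

  dot : Fin q × Fin q × Fin q → Fin q × Fin q × Fin q → Fin q
  dot (x , y , z) (a , b , c) = ((x *F a) +F (y *F b)) +F (z *F c)

  inc : Point → Line → Bool
  inc P ℓ = does (dot (coords P) (coords ℓ) ≟F 0F)

  _≟P_ : (P Q : Point) → Dec (P ≡ Q)
  pt1 y z ≟P pt1 y' z' with y ≟F y' | z ≟F z'
  ... | yes refl | yes refl = yes refl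
  ... | no ne | _ = no λ { refl → ne refl }
  ... | yes _ | no ne = no λ { refl → ne refl }
  pt1 _ _ ≟P pt2 _ = no λ ()
  pt1 _ _ ≟P pt3 = no λ ()
  pt2 _ ≟P pt1 _ _ = no λ ()
  pt2 z ≟P pt2 z' with z ≟F z'
  ... | yes refl = yes refl
  ... | no ne = no λ { refl → ne refl }
  pt2 _ ≟P pt3 = no λ ()
  pt3 ≟P pt1 _ _ = no λ ()
  pt3 ≟P pt2 _ = no λ ()
  pt3 ≟P pt3 = yes refl

  allPoints : List Point
  allPoints = concatMap (λ y → map (pt1 y) (allFinL q)) (allFinL q)
              Data.List.++ (map pt2 (allFinL q) Data.List.++ (pt3 ∷ []))

  allLines : List Line
  allLines = allPoints

  PointSet : Set
  PointSet = Point → Bool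

  _∈_ : Point → PointSet → Set
  P ∈ D = D P ≡ true

  _∉_ : Point → PointSet → Set
  P ∉ D = D P ≡ false

  _⊆_ : PointSet → PointSet → Set
  A ⊆ S = ∀ P → P ∈ A → P ∈ S

  ∣_∣ : PointSet → ℕ
  ∣ D ∣ = count D allPoints

  _∪｛_｝ : PointSet → Point → PointSet
  (D ∪｛ P ｝) Q = D Q ∨ does (Q ≟P P)

  collinear : Point → Point → Point → Set
  collinear P Q R = Σ Line λ ℓ → (inc P ℓ ≡ true) × (inc Q ℓ ≡ true) × (inc R ℓ ≡ true)

  IsArc : PointSet → Set
  IsArc D = ∀ P Q R → P ∈ D → Q ∈ D → R ∈ D →
            P ≢ Q → P ≢ R → Q ≢ R → ¬ collinear P Q R

  meet : PointSet → Line → ℕ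
  meet D ℓ = count (λ P → D P ∧ inc P ℓ) allPoints

  IsTangent : PointSet → Line → Set
  IsTangent D ℓ = meet D ℓ ≡ 1

  Is2Secant : PointSet → Line → Set
  Is2Secant D ℓ = meet D ℓ ≡ 2

  tangentsThrough : PointSet → Point → ℕ
  tangentsThrough D P = count (λ ℓ → inc P ℓ ∧ (meet D ℓ ≡ᵇ 1)) allLines

  secantsThrough : PointSet → Point → ℕ
  secantsThrough D P = count (λ ℓ → inc P ℓ ∧ (meet D ℓ ≡ᵇ 2)) allLines

  IsSMaximalArc : PointSet → PointSet → Set
  IsSMaximalArc S A = (A ⊆ S) × IsArc A × (∀ P → P ∈ S → P ∉ A → ¬ IsArc (A ∪｛ P ｝))

  IsProArcPoint : PointSet → PointSet → Point → Set
  IsProArcPoint S A P = (P ∈ S) × (P ∉ A) × (secantsThrough A P ≡ 1)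

  IsProArcSet : PointSet → PointSet → PointSet → Set
  IsProArcSet S A B =
    (∀ P → P ∈ B → IsProArcPoint S A P) ×
    (∀ ℓ → Is2Secant A ℓ → (Σ Point λ P → IsProArcPoint S A P × (inc P ℓ ≡ true)) →
       meet B ℓ ≡ 1)

  u₀ : PointSet → ℕ
  u₀ S = count (λ ℓ → meet S ℓ ≡ᵇ 0) allLines

module Submission where

open import Defs
open import Data.Nat using (ℕ)
open import Algebra.Bundles using (CommutativeRing)

-- Write i ℓ = |ℓ ∩ S|. Counting lines, incidences and pairs of points of S gives Σ 1 = q² + q + 1,
-- Σ i ℓ ≥ (q + 1)|S| and Σ i ℓ² = Σ i ℓ + |S|(|S| - 1), and the identity
-- 2[i = 0] + 3i + (i - 1)(i - 2) = 2 + i² turns these into 2 u₀(S) + Σ (i ℓ - 1)(i ℓ - 2) ≤ q(q - 1)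
-- when |S| = q + 1. Both bounds then come from the secants of A: a secant meeting S ∖ A in n points
-- contributes (n + 1)n ≥ 2n to that sum. A point of S ∖ A sees the k points of A along its tangents
-- and secants, so k ≤ λ + 2·#secants through it, which gives (1). By maximality every point of S ∖ A
-- is on a secant; a point on only one secant is a pro-arc point, and that secant carries exactly one
-- point of B to pay for it, so 4|S ∖ A| ≤ Σ (i ℓ - 1)(i ℓ - 2) + 2l, which gives (2).

module Sums where

  open import Data.Nat
  open import Data.Nat.Properties
  open import Data.Bool using (Bool; true; false; _∧_)
  open import Data.List using (List; []; _∷_; _++_; map; concatMap; length)
  open import Data.Product using (Σ; _×_; _,_)
  open import Data.List.Membership.Propositional using (_∈_)
  open import Data.List.Relation.Unary.Any using (here; there)
  open import Relation.Binary.PropositionalEquality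
  open import Algebra.Properties.CommutativeSemigroup +-commutativeSemigroup
    using () renaming (interchange to +-interchange)

  true≢false : true ≢ false
  true≢false ()

  ⟦_⟧ : Bool → ℕ
  ⟦ true ⟧ = 1
  ⟦ false ⟧ = 0

  ⟦∧⟧ : ∀ a b → ⟦ a ∧ b ⟧ ≡ ⟦ a ⟧ * ⟦ b ⟧
  ⟦∧⟧ true true = refl
  ⟦∧⟧ true false = refl
  ⟦∧⟧ false b = refl

  ∧-elim : ∀ {a b} → a ∧ b ≡ true → (a ≡ true) × (b ≡ true)
  ∧-elim {true} {true} _ = refl , refl

  ∧-intro : ∀ {a b} → a ≡ true → b ≡ true → a ∧ b ≡ true
  ∧-intro refl refl = refl

  ⟦⟧-idem : ∀ b → ⟦ b ⟧ * ⟦ b ⟧ ≡ ⟦ b ⟧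
  ⟦⟧-idem true = refl
  ⟦⟧-idem false = refl

  ⟦⟧*-when : ∀ b {n} → (b ≡ true → n ≡ 1) → ⟦ b ⟧ * n ≡ ⟦ b ⟧
  ⟦⟧*-when true n≡1 = trans (+-identityʳ _) (n≡1 refl)
  ⟦⟧*-when false _ = refl

  ⟦⟧*-monoʳ-≤ : ∀ b {m n} → (b ≡ true → m ≤ n) → ⟦ b ⟧ * m ≤ ⟦ b ⟧ * n
  ⟦⟧*-monoʳ-≤ true m≤n = *-monoʳ-≤ 1 (m≤n refl)
  ⟦⟧*-monoʳ-≤ false _ = z≤n

  ⟦⟧*n≤n : ∀ b n → ⟦ b ⟧ * n ≤ n
  ⟦⟧*n≤n true n = ≤-reflexive (+-identityʳ n)
  ⟦⟧*n≤n false n = z≤n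

  ∑ : {X : Set} → (X → ℕ) → List X → ℕ
  ∑ f [] = 0
  ∑ f (x ∷ xs) = f x + ∑ f xs

  module _ {X : Set} where

    count≡∑ : ∀ (p : X → Bool) xs → count p xs ≡ ∑ (λ x → ⟦ p x ⟧) xs
    count≡∑ p [] = refl
    count≡∑ p (x ∷ xs) with p x
    ... | true = cong suc (count≡∑ p xs)
    ... | false = count≡∑ p xs

    ∑-cong : ∀ {f g : X → ℕ} → (∀ x → f x ≡ g x) → ∀ xs → ∑ f xs ≡ ∑ g xs
    ∑-cong f≗g [] = refl
    ∑-cong f≗g (x ∷ xs) = cong₂ _+_ (f≗g x) (∑-cong f≗g xs)

    ∑-mono-≤ : ∀ {f g : X → ℕ} → (∀ x → f x ≤ g x) → ∀ xs → ∑ f xs ≤ ∑ g xs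
    ∑-mono-≤ f≤g [] = ≤-refl
    ∑-mono-≤ f≤g (x ∷ xs) = +-mono-≤ (f≤g x) (∑-mono-≤ f≤g xs)

    ∑-+ : ∀ (f g : X → ℕ) xs → ∑ (λ x → f x + g x) xs ≡ ∑ f xs + ∑ g xs
    ∑-+ f g [] = refl
    ∑-+ f g (x ∷ xs) rewrite ∑-+ f g xs = +-interchange (f x) (g x) (∑ f xs) (∑ g xs)

    ∑-*ˡ : ∀ c (f : X → ℕ) xs → ∑ (λ x → c * f x) xs ≡ c * ∑ f xs
    ∑-*ˡ c f [] = sym (*-zeroʳ c)
    ∑-*ˡ c f (x ∷ xs) rewrite ∑-*ˡ c f xs = sym (*-distribˡ-+ c (f x) (∑ f xs))

    ∑-++ : ∀ (f : X → ℕ) xs ys → ∑ f (xs ++ ys) ≡ ∑ f xs + ∑ f ys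
    ∑-++ f [] ys = refl
    ∑-++ f (x ∷ xs) ys rewrite ∑-++ f xs ys = sym (+-assoc (f x) (∑ f xs) (∑ f ys))

    ∑-const : ∀ c xs → ∑ (λ (_ : X) → c) xs ≡ c * length xs
    ∑-const c [] = sym (*-zeroʳ c)
    ∑-const c (x ∷ xs) rewrite ∑-const c xs = sym (*-suc c (length xs))

    ∑-zero : ∀ (f : X → ℕ) → (∀ x → f x ≡ 0) → ∀ xs → ∑ f xs ≡ 0
    ∑-zero f f≗0 [] = refl
    ∑-zero f f≗0 (x ∷ xs) rewrite f≗0 x = ∑-zero f f≗0 xs

    term≤∑ : ∀ (f : X → ℕ) {x xs} → x ∈ xs → f x ≤ ∑ f xs
    term≤∑ f {xs = y ∷ ys} (here refl) = m≤m+n (f y) (∑ f ys)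
    term≤∑ f {xs = y ∷ ys} (there x∈ys) = ≤-trans (term≤∑ f x∈ys) (m≤n+m (∑ f ys) (f y))

    ∑-witness : ∀ (p : X → Bool) xs → 1 ≤ ∑ (λ x → ⟦ p x ⟧) xs → Σ X λ x → p x ≡ true
    ∑-witness p (x ∷ xs) 1≤∑ with p x in px
    ... | true = x , px
    ... | false = ∑-witness p xs 1≤∑

  module _ {X Y : Set} where

    ∑-comm : ∀ (f : X → Y → ℕ) xs ys →
             ∑ (λ x → ∑ (f x) ys) xs ≡ ∑ (λ y → ∑ (λ x → f x y) xs) ys
    ∑-comm f [] ys = sym (∑-zero _ (λ _ → refl) ys)
    ∑-comm f (x ∷ xs) ys rewrite ∑-comm f xs ys = sym (∑-+ (f x) (λ y → ∑ (λ x′ → f x′ y) xs) ys)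

    ∑-map : ∀ (f : Y → ℕ) (h : X → Y) xs → ∑ f (map h xs) ≡ ∑ (λ x → f (h x)) xs
    ∑-map f h [] = refl
    ∑-map f h (x ∷ xs) = cong (f (h x) +_) (∑-map f h xs)

    ∑-concatMap : ∀ (f : Y → ℕ) (g : X → List Y) xs →
                  ∑ f (concatMap g xs) ≡ ∑ (λ x → ∑ f (g x)) xs
    ∑-concatMap f g [] = refl
    ∑-concatMap f g (x ∷ xs) =
      trans (∑-++ f (g x) (concatMap g xs)) (cong (∑ f (g x) +_) (∑-concatMap f g xs))

-- Coefficients are integers: normal forms are compared by computation, which the elements of an
-- abstract ring do not allow.
module IntegerSolver {c ℓ} (R : CommutativeRing c ℓ) where

  open import Data.Nat as ℕ using (ℕ; zero; suc)
  import Data.Nat.Properties as ℕ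
  open import Data.Integer as ℤ using (ℤ; +_; -[1+_]; _⊖_)
  import Data.Integer.Properties as ℤ
  open import Data.Sign as Sign using (Sign)
  open import Data.Maybe using (just; nothing)
  open import Relation.Nullary using (yes; no)
  open import Relation.Binary.PropositionalEquality as ≡ using (_≡_)
  open import Relation.Binary.Definitions using (WeaklyDecidable)
  open import Algebra.Solver.Ring.AlmostCommutativeRing
    using (fromCommutativeRing; _-Raw-AlmostCommutative⟶_; Induced-equivalence)

  open CommutativeRing R
  open import Algebra.Properties.Ring ring
    using (-0#≈0#; -‿involutive; -‿+-comm; -‿distribˡ-*; -‿distribʳ-*)
  open import Algebra.Properties.Semiring.Mult.TCOptimised semiring using (_×_; 1+×; ×-homo-+; ×1-homo-*)
  open import Algebra.Properties.CommutativeSemigroup +-commutativeSemigroup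
    using () renaming (interchange to +-interchange)
  open import Relation.Binary.Reasoning.Setoid setoid

  -- This _×_ makes 1 × 1# reduce to 1#, so that con (+ 1) denotes 1# definitionally.
  ι : ℤ → Carrier
  ι (+ n) = n × 1#
  ι -[1+ n ] = - (suc n × 1#)

  private
    x-y≈[z+x]-[z+y] : ∀ x y z → x - y ≈ (z + x) - (z + y)
    x-y≈[z+x]-[z+y] x y z = begin
      x - y                    ≈⟨ +-identityˡ (x - y) ⟨
      0# + (x - y)             ≈⟨ +-congʳ (-‿inverseʳ z) ⟨
      (z - z) + (x - y)        ≈⟨ +-interchange z (- z) x (- y) ⟩
      (z + x) + (- z + - y)    ≈⟨ +-congˡ (-‿+-comm z y) ⟩
      (z + x) - (z + y)        ∎

    ι-⊖ : ∀ m n → ι (m ⊖ n) ≈ m × 1# - n × 1#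
    ι-⊖ m zero = begin
      m × 1#        ≈⟨ +-identityʳ (m × 1#) ⟨
      m × 1# + 0#   ≈⟨ +-congˡ -0#≈0# ⟨
      m × 1# - 0#   ∎
    ι-⊖ zero (suc n) = sym (+-identityˡ _)
    ι-⊖ (suc m) (suc n) = begin
      ι (suc m ⊖ suc n)  ≡⟨ ≡.cong ι (ℤ.[1+m]⊖[1+n]≡m⊖n m n) ⟩
      ι (m ⊖ n)          ≈⟨ ι-⊖ m n ⟩
      m × 1# - n × 1#    ≈⟨ x-y≈[z+x]-[z+y] (m × 1#) (n × 1#) 1# ⟩
      (1# + m × 1#) - (1# + n × 1#) ≈⟨ +-cong (1+× m 1#) (-‿cong (1+× n 1#)) ⟨
      suc m × 1# - suc n × 1# ∎

    ι-+ : ∀ i j → ι (i ℤ.+ j) ≈ ι i + ι j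
    ι-+ (+ m) (+ n) = ×-homo-+ 1# m n
    ι-+ (+ m) -[1+ n ] = ι-⊖ m (suc n)
    ι-+ -[1+ m ] (+ n) = trans (ι-⊖ n (suc m)) (+-comm _ _)
    ι-+ -[1+ m ] -[1+ n ] = begin
      - (suc (suc (m ℕ.+ n)) × 1#)  ≡⟨ ≡.cong (λ k → - (suc k × 1#)) (ℕ.+-suc m n) ⟨
      - ((suc m ℕ.+ suc n) × 1#)    ≈⟨ -‿cong (×-homo-+ 1# (suc m) (suc n)) ⟩
      - (suc m × 1# + suc n × 1#)   ≈⟨ -‿+-comm (suc m × 1#) (suc n × 1#) ⟨
      ι -[1+ m ] + ι -[1+ n ]       ∎

    ι-neg : ∀ i → ι (ℤ.- i) ≈ - ι i
    ι-neg (+ zero) = sym -0#≈0#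
    ι-neg (+ suc n) = refl
    ι-neg -[1+ n ] = sym (-‿involutive _)

    signed : Sign → Carrier → Carrier
    signed Sign.+ x = x
    signed Sign.- x = - x

    ι-◃ : ∀ s n → ι (s ℤ.◃ n) ≈ signed s (n × 1#)
    ι-◃ Sign.+ zero = refl
    ι-◃ Sign.- zero = sym -0#≈0#
    ι-◃ Sign.+ (suc n) = refl
    ι-◃ Sign.- (suc n) = refl

    ι-sign-abs : ∀ i → ι i ≈ signed (ℤ.sign i) (ℤ.∣ i ∣ × 1#)
    ι-sign-abs (+ zero) = refl
    ι-sign-abs (+ suc n) = refl
    ι-sign-abs -[1+ n ] = refl

    signed-* : ∀ s t x y → signed (s Sign.* t) (x * y) ≈ signed s x * signed t y
    signed-* Sign.+ Sign.+ x y = refl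
    signed-* Sign.+ Sign.- x y = -‿distribʳ-* x y
    signed-* Sign.- Sign.+ x y = -‿distribˡ-* x y
    signed-* Sign.- Sign.- x y = begin
      x * y            ≈⟨ -‿involutive (x * y) ⟨
      - (- (x * y))    ≈⟨ -‿cong (-‿distribˡ-* x y) ⟩
      - (- x * y)      ≈⟨ -‿distribʳ-* (- x) y ⟩
      - x * - y        ∎

    ι-* : ∀ i j → ι (i ℤ.* j) ≈ ι i * ι j
    ι-* i j = begin
      ι (i ℤ.* j)                              ≈⟨ ι-◃ (s Sign.* t) (ℤ.∣ i ∣ ℕ.* ℤ.∣ j ∣) ⟩
      signed (s Sign.* t) ((ℤ.∣ i ∣ ℕ.* ℤ.∣ j ∣) × 1#)
        ≈⟨ signed-cong (s Sign.* t) (×1-homo-* ℤ.∣ i ∣ ℤ.∣ j ∣) ⟩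
      signed (s Sign.* t) ((ℤ.∣ i ∣ × 1#) * (ℤ.∣ j ∣ × 1#))
        ≈⟨ signed-* s t _ _ ⟩
      signed s (ℤ.∣ i ∣ × 1#) * signed t (ℤ.∣ j ∣ × 1#)
        ≈⟨ *-cong (ι-sign-abs i) (ι-sign-abs j) ⟨
      ι i * ι j                                ∎
      where
      s = ℤ.sign i
      t = ℤ.sign j
      signed-cong : ∀ s {x y} → x ≈ y → signed s x ≈ signed s y
      signed-cong Sign.+ x≈y = x≈y
      signed-cong Sign.- x≈y = -‿cong x≈y

  ι-homomorphism : ℤ.+-*-rawRing -Raw-AlmostCommutative⟶ fromCommutativeRing R
  ι-homomorphism = record
    { ⟦_⟧ = ι
    ; +-homo = ι-+
    ; *-homo = ι-*
    ; -‿homo = ι-neg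
    ; 0-homo = refl
    ; 1-homo = refl
    }

  private
    _≟ι_ : WeaklyDecidable (Induced-equivalence ι-homomorphism)
    i ≟ι j with i ℤ.≟ j
    ... | yes ≡.refl = just refl
    ... | no _ = nothing

  open import Algebra.Solver.Ring ℤ.+-*-rawRing (fromCommutativeRing R) ι-homomorphism _≟ι_ public

module Plane {q : ℕ} (F : FiniteField q) where

  open import Data.Fin using (Fin)
  open import Data.Fin.Properties using () renaming (_≟_ to _≟F_)
  open import Data.Integer using (+_)
  open import Data.Product using (Σ; _×_; _,_)
  open import Data.Empty using (⊥-elim)
  open import Data.Bool using (true; false)
  open import Relation.Nullary using (¬_; yes; no; does)
  open import Relation.Nullary.Decidable using (dec-true; dec-false)
  open import Relation.Binary.PropositionalEquality

  open FiniteField F using (0F; 1F; 0≢1; inverse; isCommutativeRing)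
  open PG F

  fieldRing : CommutativeRing _ _
  fieldRing = record { isCommutativeRing = isCommutativeRing }

  open CommutativeRing fieldRing using (_+_; _*_; -_; _-_; *-identityˡ; *-comm; zeroʳ; ring)
  open import Algebra.Properties.Ring ring using (x∙y⁻¹≈ε⇒x≈y)
  open IntegerSolver fieldRing using (Polynomial; solve; _:=_; _:+_; _:*_; _:-_; :-_; con)

  Vec3 : Set
  Vec3 = Fin q × Fin q × Fin q

  _⨯_ : Vec3 → Vec3 → Vec3
  (u₁ , u₂ , u₃) ⨯ (v₁ , v₂ , v₃) = u₂ * v₃ - u₃ * v₂ , u₃ * v₁ - u₁ * v₃ , u₁ * v₂ - u₂ * v₁

  _•_ : Fin q → Vec3 → Vec3
  s • (v₁ , v₂ , v₃) = s * v₁ , s * v₂ , s * v₃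

  IsZero : Vec3 → Set
  IsZero (v₁ , v₂ , v₃) = (v₁ ≡ 0F) × (v₂ ≡ 0F) × (v₃ ≡ 0F)

  _∥_ : Vec3 → Vec3 → Set
  u ∥ v = IsZero (u ⨯ v)

  x*y≡0⇒y≡0 : ∀ {x y} → x ≢ 0F → x * y ≡ 0F → y ≡ 0F
  x*y≡0⇒y≡0 {x} {y} x≢0 xy≡0 with inverse x x≢0
  ... | x⁻¹ , xx⁻¹≡1 = begin
    y               ≡⟨ *-identityˡ y ⟨
    1F * y          ≡⟨ cong (_* y) xx⁻¹≡1 ⟨
    x * x⁻¹ * y     ≡⟨ solve 3 (λ x y x⁻¹ → x :* x⁻¹ :* y := x⁻¹ :* (x :* y)) refl x y x⁻¹ ⟩
    x⁻¹ * (x * y)   ≡⟨ cong (x⁻¹ *_) xy≡0 ⟩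
    x⁻¹ * 0F        ≡⟨ zeroʳ x⁻¹ ⟩
    0F              ∎
    where open ≡-Reasoning

  rotate : Vec3 → Vec3
  rotate (v₁ , v₂ , v₃) = v₂ , v₃ , v₁

  -- rotate u ⨯ rotate v is rotate (u ⨯ v) on the nose.
  rotate-∥ : ∀ {u v} → u ∥ v → rotate u ∥ rotate v
  rotate-∥ (z₁ , z₂ , z₃) = z₂ , z₃ , z₁

  unrotate-∥ : ∀ {u v} → rotate u ∥ rotate v → u ∥ v
  unrotate-∥ (z₂ , z₃ , z₁) = z₁ , z₂ , z₃

  private
    :0 :1 : ∀ {n} → Polynomial n
    :0 = con (+ 0)
    :1 = con (+ 1)

  -- Multiplying a component of a ⨯ b by w₁ gives a combination of components of a ⨯ w and b ⨯ w.
  ∥-via₁ : ∀ {a b w₁ w₂ w₃} → w₁ ≢ 0F → a ∥ (w₁ , w₂ , w₃) → b ∥ (w₁ , w₂ , w₃) → a ∥ b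
  ∥-via₁ {a₁ , a₂ , a₃} {b₁ , b₂ , b₃} {w₁} {w₂} {w₃} w₁≢0 (_ , aw₂ , aw₃) (bw₁ , bw₂ , bw₃) =
    x*y≡0⇒y≡0 w₁≢0 (trans (solve 9 (λ a₁ a₂ a₃ b₁ b₂ b₃ w₁ w₂ w₃ →
        w₁ :* (a₂ :* b₃ :- a₃ :* b₂) :=
        :- a₁ :* (b₂ :* w₃ :- b₃ :* w₂) :+ :- b₃ :* (a₁ :* w₂ :- a₂ :* w₁) :+ :- b₂ :* (a₃ :* w₁ :- a₁ :* w₃))
        refl a₁ a₂ a₃ b₁ b₂ b₃ w₁ w₂ w₃) (combination₃ (- a₁) (- b₃) (- b₂) bw₁ aw₃ aw₂)) ,
    x*y≡0⇒y≡0 w₁≢0 (trans (solve 9 (λ a₁ a₂ a₃ b₁ b₂ b₃ w₁ w₂ w₃ →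
        w₁ :* (a₃ :* b₁ :- a₁ :* b₃) := :- a₁ :* (b₃ :* w₁ :- b₁ :* w₃) :+ b₁ :* (a₃ :* w₁ :- a₁ :* w₃))
        refl a₁ a₂ a₃ b₁ b₂ b₃ w₁ w₂ w₃) (combination₂ (- a₁) b₁ bw₂ aw₂)) ,
    x*y≡0⇒y≡0 w₁≢0 (trans (solve 9 (λ a₁ a₂ a₃ b₁ b₂ b₃ w₁ w₂ w₃ →
        w₁ :* (a₁ :* b₂ :- a₂ :* b₁) := :- a₁ :* (b₁ :* w₂ :- b₂ :* w₁) :+ b₁ :* (a₁ :* w₂ :- a₂ :* w₁))
        refl a₁ a₂ a₃ b₁ b₂ b₃ w₁ w₂ w₃) (combination₂ (- a₁) b₁ bw₃ aw₃))
    where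
    combination₂ : ∀ c d {x y} → x ≡ 0F → y ≡ 0F → c * x + d * y ≡ 0F
    combination₂ c d refl refl = solve 2 (λ c d → c :* :0 :+ d :* :0 := :0) refl c d
    combination₃ : ∀ c d e {x y z} → x ≡ 0F → y ≡ 0F → z ≡ 0F → c * x + d * y + e * z ≡ 0F
    combination₃ c d e refl refl refl = solve 3 (λ c d e → c :* :0 :+ d :* :0 :+ e :* :0 := :0) refl c d e

  ∥-via : ∀ {a b} w → ¬ IsZero w → a ∥ w → b ∥ w → a ∥ b
  ∥-via {a} {b} (w₁ , w₂ , w₃) w≢0 a∥w b∥w with w₁ ≟F 0F | w₂ ≟F 0F | w₃ ≟F 0F
  ... | no w₁≢0 | _ | _ = ∥-via₁ w₁≢0 a∥w b∥w
  ... | yes _ | no w₂≢0 | _ = unrotate-∥ (∥-via₁ w₂≢0 (rotate-∥ a∥w) (rotate-∥ b∥w))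
  ... | yes _ | yes _ | no w₃≢0 =
    unrotate-∥ (unrotate-∥ (∥-via₁ w₃≢0 (rotate-∥ (rotate-∥ a∥w)) (rotate-∥ (rotate-∥ b∥w))))
  ... | yes w₁≡0 | yes w₂≡0 | yes w₃≡0 = ⊥-elim (w≢0 (w₁≡0 , w₂≡0 , w₃≡0))

  _·_ : Vec3 → Vec3 → Fin q
  _·_ = dot

  ·-comm : ∀ u v → u · v ≡ v · u
  ·-comm (u₁ , u₂ , u₃) (v₁ , v₂ , v₃) = solve 6 (λ u₁ u₂ u₃ v₁ v₂ v₃ →
    u₁ :* v₁ :+ u₂ :* v₂ :+ u₃ :* v₃ := v₁ :* u₁ :+ v₂ :* u₂ :+ v₃ :* u₃) refl u₁ u₂ u₃ v₁ v₂ v₃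

  ·-•ʳ : ∀ x s v → x · (s • v) ≡ s * (x · v)
  ·-•ʳ (x₁ , x₂ , x₃) s (v₁ , v₂ , v₃) = solve 7 (λ x₁ x₂ x₃ s v₁ v₂ v₃ →
    x₁ :* (s :* v₁) :+ x₂ :* (s :* v₂) :+ x₃ :* (s :* v₃) := s :* (x₁ :* v₁ :+ x₂ :* v₂ :+ x₃ :* v₃))
    refl x₁ x₂ x₃ s v₁ v₂ v₃

  ⨯-orthogonalˡ : ∀ u v → u · (u ⨯ v) ≡ 0F
  ⨯-orthogonalˡ (u₁ , u₂ , u₃) (v₁ , v₂ , v₃) = solve 6 (λ u₁ u₂ u₃ v₁ v₂ v₃ →
    u₁ :* (u₂ :* v₃ :- u₃ :* v₂) :+ u₂ :* (u₃ :* v₁ :- u₁ :* v₃) :+ u₃ :* (u₁ :* v₂ :- u₂ :* v₁) := :0)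
    refl u₁ u₂ u₃ v₁ v₂ v₃

  ⨯-orthogonalʳ : ∀ u v → v · (u ⨯ v) ≡ 0F
  ⨯-orthogonalʳ (u₁ , u₂ , u₃) (v₁ , v₂ , v₃) = solve 6 (λ u₁ u₂ u₃ v₁ v₂ v₃ →
    v₁ :* (u₂ :* v₃ :- u₃ :* v₂) :+ v₂ :* (u₃ :* v₁ :- u₁ :* v₃) :+ v₃ :* (u₁ :* v₂ :- u₂ :* v₁) := :0)
    refl u₁ u₂ u₃ v₁ v₂ v₃

  -- x ⨯ (u ⨯ v) = (x · v) u - (x · u) v, read componentwise.
  orthogonal⇒∥⨯ : ∀ x u v → x · u ≡ 0F → x · v ≡ 0F → x ∥ (u ⨯ v)
  orthogonal⇒∥⨯ (x₁ , x₂ , x₃) (u₁ , u₂ , u₃) (v₁ , v₂ , v₃) xu≡0 xv≡0 =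
    trans (solve 9 (λ x₁ x₂ x₃ u₁ u₂ u₃ v₁ v₂ v₃ →
      x₂ :* (u₁ :* v₂ :- u₂ :* v₁) :- x₃ :* (u₃ :* v₁ :- u₁ :* v₃) :=
      u₁ :* (x₁ :* v₁ :+ x₂ :* v₂ :+ x₃ :* v₃) :- v₁ :* (x₁ :* u₁ :+ x₂ :* u₂ :+ x₃ :* u₃))
      refl x₁ x₂ x₃ u₁ u₂ u₃ v₁ v₂ v₃) (vanishes u₁ v₁) ,
    trans (solve 9 (λ x₁ x₂ x₃ u₁ u₂ u₃ v₁ v₂ v₃ →
      x₃ :* (u₂ :* v₃ :- u₃ :* v₂) :- x₁ :* (u₁ :* v₂ :- u₂ :* v₁) :=
      u₂ :* (x₁ :* v₁ :+ x₂ :* v₂ :+ x₃ :* v₃) :- v₂ :* (x₁ :* u₁ :+ x₂ :* u₂ :+ x₃ :* u₃))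
      refl x₁ x₂ x₃ u₁ u₂ u₃ v₁ v₂ v₃) (vanishes u₂ v₂) ,
    trans (solve 9 (λ x₁ x₂ x₃ u₁ u₂ u₃ v₁ v₂ v₃ →
      x₁ :* (u₃ :* v₁ :- u₁ :* v₃) :- x₂ :* (u₂ :* v₃ :- u₃ :* v₂) :=
      u₃ :* (x₁ :* v₁ :+ x₂ :* v₂ :+ x₃ :* v₃) :- v₃ :* (x₁ :* u₁ :+ x₂ :* u₂ :+ x₃ :* u₃))
      refl x₁ x₂ x₃ u₁ u₂ u₃ v₁ v₂ v₃) (vanishes u₃ v₃)
    where
    vanishes : ∀ a b → a * (x₁ * v₁ + x₂ * v₂ + x₃ * v₃) - b * (x₁ * u₁ + x₂ * u₂ + x₃ * u₃) ≡ 0F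
    vanishes a b rewrite xu≡0 | xv≡0 = solve 2 (λ a b → a :* :0 :- b :* :0 := :0) refl a b

  s*0≡0 : ∀ s {w} → w ≡ 0F → s * w ≡ 0F
  s*0≡0 s refl = zeroʳ s

  normalise : ∀ w → ¬ IsZero w → Σ Point λ P → Σ (Fin q) λ s → coords P ≡ s • w
  normalise (w₁ , w₂ , w₃) w≢0 with w₁ ≟F 0F | w₂ ≟F 0F | w₃ ≟F 0F
  ... | no w₁≢0 | _ | _ with inverse w₁ w₁≢0
  ...   | s , w₁s≡1 = pt1 (w₂ * s) (w₃ * s) , s ,
          cong₂ _,_ (trans (sym w₁s≡1) (*-comm w₁ s)) (cong₂ _,_ (*-comm w₂ s) (*-comm w₃ s))
  normalise (w₁ , w₂ , w₃) w≢0 | yes w₁≡0 | no w₂≢0 | _ with inverse w₂ w₂≢0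
  ...   | s , w₂s≡1 = pt2 (w₃ * s) , s ,
          cong₂ _,_ (sym (s*0≡0 s w₁≡0)) (cong₂ _,_ (trans (sym w₂s≡1) (*-comm w₂ s)) (*-comm w₃ s))
  normalise (w₁ , w₂ , w₃) w≢0 | yes w₁≡0 | yes w₂≡0 | no w₃≢0 with inverse w₃ w₃≢0
  ...   | s , w₃s≡1 = pt3 , s ,
          cong₂ _,_ (sym (s*0≡0 s w₁≡0)) (cong₂ _,_ (sym (s*0≡0 s w₂≡0)) (trans (sym w₃s≡1) (*-comm w₃ s)))
  normalise _ w≢0 | yes w₁≡0 | yes w₂≡0 | yes w₃≡0 = ⊥-elim (w≢0 (w₁≡0 , w₂≡0 , w₃≡0))

  1≢0 : 1F ≢ 0F
  1≢0 1≡0 = 0≢1 (sym 1≡0)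

  -1≢0 : - 1F ≢ 0F
  -1≢0 -1≡0 = 1≢0 (begin
    1F       ≡⟨ solve 0 (:1 := :- :- :1) refl ⟩
    - - 1F   ≡⟨ cong -_ -1≡0 ⟩
    - 0F     ≡⟨ solve 0 (:- :0 := :0) refl ⟩
    0F       ∎)
    where open ≡-Reasoning

  -- In each mixed case some component of the cross product is ±1.
  coords-∥⇒≡ : ∀ P Q → coords P ∥ coords Q → P ≡ Q
  coords-∥⇒≡ (pt1 y z) (pt1 y′ z′) (_ , e₂ , e₃) = cong₂ pt1
    (sym (x∙y⁻¹≈ε⇒x≈y y′ y (trans (solve 2 (λ y′ y → y′ :- y := :1 :* y′ :- y :* :1) refl y′ y) e₃)))
    (x∙y⁻¹≈ε⇒x≈y z z′ (trans (solve 2 (λ z z′ → z :- z′ := z :* :1 :- :1 :* z′) refl z z′) e₂))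
  coords-∥⇒≡ (pt1 y z) (pt2 z′) (_ , _ , e₃) =
    ⊥-elim (1≢0 (trans (solve 1 (λ y → :1 := :1 :* :1 :- y :* :0) refl y) e₃))
  coords-∥⇒≡ (pt1 y z) pt3 (_ , e₂ , _) =
    ⊥-elim (-1≢0 (trans (solve 1 (λ z → :- :1 := z :* :0 :- :1 :* :1) refl z) e₂))
  coords-∥⇒≡ (pt2 z) (pt1 y′ z′) (_ , _ , e₃) =
    ⊥-elim (-1≢0 (trans (solve 1 (λ y′ → :- :1 := :0 :* y′ :- :1 :* :1) refl y′) e₃))
  coords-∥⇒≡ (pt2 z) (pt2 z′) (e₁ , _ , _) = cong pt2
    (sym (x∙y⁻¹≈ε⇒x≈y z′ z (trans (solve 2 (λ z′ z → z′ :- z := :1 :* z′ :- z :* :1) refl z′ z) e₁)))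
  coords-∥⇒≡ (pt2 z) pt3 (e₁ , _ , _) =
    ⊥-elim (1≢0 (trans (solve 1 (λ z → :1 := :1 :* :1 :- z :* :0) refl z) e₁))
  coords-∥⇒≡ pt3 (pt1 y z) (_ , e₂ , _) =
    ⊥-elim (1≢0 (trans (solve 1 (λ z → :1 := :1 :* :1 :- :0 :* z) refl z) e₂))
  coords-∥⇒≡ pt3 (pt2 z) (e₁ , _ , _) =
    ⊥-elim (-1≢0 (trans (solve 1 (λ z → :- :1 := :0 :* z :- :1 :* :1) refl z) e₁))
  coords-∥⇒≡ pt3 pt3 _ = refl

  ·≡0⇒inc : ∀ P ℓ → coords P · coords ℓ ≡ 0F → inc P ℓ ≡ true
  ·≡0⇒inc P ℓ = dec-true (coords P · coords ℓ ≟F 0F)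

  inc⇒·≡0 : ∀ P ℓ → inc P ℓ ≡ true → coords P · coords ℓ ≡ 0F
  inc⇒·≡0 P ℓ P∈ℓ with coords P · coords ℓ ≟F 0F
  ... | yes P·ℓ≡0 = P·ℓ≡0

  inc-sym : ∀ P ℓ → inc P ℓ ≡ inc ℓ P
  inc-sym P ℓ = cong (λ x → does (x ≟F 0F)) (·-comm (coords P) (coords ℓ))

  -- The line through P and Q has coordinates proportional to P ⨯ Q.
  line-through : ∀ P Q → P ≢ Q → Σ Line λ ℓ → (inc P ℓ ≡ true) × (inc Q ℓ ≡ true)
  line-through P Q P≢Q with normalise (coords P ⨯ coords Q) (λ P∥Q → P≢Q (coords-∥⇒≡ P Q P∥Q))
  ... | ℓ , s , ℓ≡s•P⨯Q =
    ℓ , ·≡0⇒inc P ℓ (on-ℓ (⨯-orthogonalˡ (coords P) (coords Q)))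
      , ·≡0⇒inc Q ℓ (on-ℓ (⨯-orthogonalʳ (coords P) (coords Q)))
    where
    on-ℓ : ∀ {x} → x · (coords P ⨯ coords Q) ≡ 0F → x · coords ℓ ≡ 0F
    on-ℓ {x} x·P⨯Q≡0 = begin
      x · coords ℓ                  ≡⟨ cong (x ·_) ℓ≡s•P⨯Q ⟩
      x · (s • (coords P ⨯ coords Q)) ≡⟨ ·-•ʳ x s _ ⟩
      s * (x · (coords P ⨯ coords Q)) ≡⟨ s*0≡0 s x·P⨯Q≡0 ⟩
      0F                            ∎
      where open ≡-Reasoning

  line-unique : ∀ P Q ℓ ℓ′ → P ≢ Q →
                inc P ℓ ≡ true → inc Q ℓ ≡ true → inc P ℓ′ ≡ true → inc Q ℓ′ ≡ true → ℓ ≡ ℓ′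
  line-unique P Q ℓ ℓ′ P≢Q P∈ℓ Q∈ℓ P∈ℓ′ Q∈ℓ′ =
    coords-∥⇒≡ ℓ ℓ′ (∥-via (coords P ⨯ coords Q) (λ P∥Q → P≢Q (coords-∥⇒≡ P Q P∥Q))
      (∥-P⨯Q ℓ P∈ℓ Q∈ℓ) (∥-P⨯Q ℓ′ P∈ℓ′ Q∈ℓ′))
    where
    ∥-P⨯Q : ∀ m → inc P m ≡ true → inc Q m ≡ true → coords m ∥ (coords P ⨯ coords Q)
    ∥-P⨯Q m P∈m Q∈m = orthogonal⇒∥⨯ (coords m) (coords P) (coords Q)
      (trans (·-comm (coords m) (coords P)) (inc⇒·≡0 P m P∈m))
      (trans (·-comm (coords m) (coords Q)) (inc⇒·≡0 Q m Q∈m))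

  ·≡1⇒¬inc : ∀ P ℓ → coords P · coords ℓ ≡ 1F → inc P ℓ ≡ false
  ·≡1⇒¬inc P ℓ P·ℓ≡1 = dec-false (coords P · coords ℓ ≟F 0F) (λ P·ℓ≡0 → 1≢0 (trans (sym P·ℓ≡1) P·ℓ≡0))

  pt3∈pt1[y,0] : ∀ y → inc pt3 (pt1 y 0F) ≡ true
  pt3∈pt1[y,0] y = ·≡0⇒inc pt3 (pt1 y 0F) (solve 1 (λ y → :0 :* :1 :+ :0 :* y :+ :1 :* :0 := :0) refl y)

  pt3∈pt2[0] : inc pt3 (pt2 0F) ≡ true
  pt3∈pt2[0] = ·≡0⇒inc pt3 (pt2 0F) (solve 0 (:0 :* :0 :+ :0 :* :1 :+ :1 :* :0 := :0) refl)

  line-avoiding : ∀ P → inc P pt3 ≡ true → Σ Line λ m → (inc P m ≡ false) × (inc m pt3 ≡ false)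
  line-avoiding (pt1 y z) P∈pt3 =
    pt1 0F 1F ,
    ·≡1⇒¬inc (pt1 y z) (pt1 0F 1F) (begin
      1F * 1F + y * 0F + z * 1F    ≡⟨ cong (λ z → 1F * 1F + y * 0F + z * 1F) z≡0 ⟩
      1F * 1F + y * 0F + 0F * 1F   ≡⟨ solve 1 (λ y → :1 :* :1 :+ y :* :0 :+ :0 :* :1 := :1) refl y ⟩
      1F                           ∎) ,
    ·≡1⇒¬inc (pt1 0F 1F) pt3 (solve 0 (:1 :* :0 :+ :0 :* :0 :+ :1 :* :1 := :1) refl)
    where
    open ≡-Reasoning
    z≡0 : z ≡ 0F
    z≡0 = trans (solve 2 (λ y z → z := :1 :* :0 :+ y :* :0 :+ z :* :1) refl y z) (inc⇒·≡0 (pt1 y z) pt3 P∈pt3)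
  line-avoiding (pt2 z) P∈pt3 =
    pt2 1F ,
    ·≡1⇒¬inc (pt2 z) (pt2 1F) (begin
      0F * 0F + 1F * 1F + z * 1F    ≡⟨ cong (λ z → 0F * 0F + 1F * 1F + z * 1F) z≡0 ⟩
      0F * 0F + 1F * 1F + 0F * 1F   ≡⟨ solve 0 (:0 :* :0 :+ :1 :* :1 :+ :0 :* :1 := :1) refl ⟩
      1F                            ∎) ,
    ·≡1⇒¬inc (pt2 1F) pt3 (solve 0 (:0 :* :0 :+ :1 :* :0 :+ :1 :* :1 := :1) refl)
    where
    open ≡-Reasoning
    z≡0 : z ≡ 0F
    z≡0 = trans (solve 1 (λ z → z := :0 :* :0 :+ :1 :* :0 :+ z :* :1) refl z) (inc⇒·≡0 (pt2 z) pt3 P∈pt3)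
  line-avoiding pt3 pt3∈pt3 with () ← trans (sym pt3∈pt3)
    (·≡1⇒¬inc pt3 pt3 (solve 0 (:0 :* :0 :+ :0 :* :0 :+ :1 :* :1 := :1) refl))

module LineCounts {q : ℕ} (F : FiniteField q) where

  open import Data.Nat using (zero; suc; _+_; _*_; _≤_; z≤n; s≤s; s≤s⁻¹)
  open import Data.Nat.Properties
  open import Data.Fin using (Fin)
  import Data.Fin as Fin
  open import Data.Fin.Properties using () renaming (_≟_ to _≟F_)
  open import Data.List using (List; []; _∷_; map) renaming (allFin to allFinL)
  import Data.List as List
  open import Data.List.Properties using (map-tabulate; length-tabulate)
  open import Data.List.Membership.Propositional.Properties using (∈-allFin)
  open import Data.Product using (Σ; _×_; _,_)
  open import Data.Empty using (⊥-elim)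
  open import Data.Bool using (Bool; true; false; _∧_; not)
  open import Relation.Nullary using (yes; no; does)
  open import Relation.Nullary.Decidable using (dec-true)
  open import Relation.Binary.PropositionalEquality
  open import Function using (_∘_; id)
  open import Data.Nat.Tactic.RingSolver using (solve-∀)

  open FiniteField F using (0F)
  open PG F
  open Sums
  open Plane F using (line-through; line-unique; inc-sym; pt3∈pt1[y,0]; pt3∈pt2[0]; line-avoiding)

  ∑-allFin-suc : ∀ {n} (f : Fin (suc n) → ℕ) → ∑ f (allFinL (suc n)) ≡ f Fin.zero + ∑ (f ∘ Fin.suc) (allFinL n)
  ∑-allFin-suc {n} f = cong (f Fin.zero +_) (begin
    ∑ f (List.tabulate Fin.suc)        ≡⟨ cong (∑ f) (map-tabulate id Fin.suc) ⟨
    ∑ f (map Fin.suc (allFinL n))      ≡⟨ ∑-map f Fin.suc (allFinL n) ⟩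
    ∑ (f ∘ Fin.suc) (allFinL n)        ∎)
    where open ≡-Reasoning

  ∑-δ-allFin : ∀ {n} (a : Fin n) → ∑ (λ z → ⟦ does (z ≟F a) ⟧) (allFinL n) ≡ 1
  ∑-δ-allFin {suc n} Fin.zero = trans (∑-allFin-suc {n} (λ z → ⟦ does (z ≟F Fin.zero) ⟧))
    (cong suc (∑-zero (λ z → ⟦ does (Fin.suc z ≟F Fin.zero) ⟧) (λ _ → refl) (allFinL n)))
  ∑-δ-allFin {suc n} (Fin.suc a) =
    trans (∑-allFin-suc {n} (λ z → ⟦ does (z ≟F Fin.suc a) ⟧)) (∑-δ-allFin a)

  ∑ᶠ : (Fin q → ℕ) → ℕ
  ∑ᶠ f = ∑ f (allFinL q)

  ∑ᶠ-const : ∀ c → ∑ᶠ (λ _ → c) ≡ c * q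
  ∑ᶠ-const c = trans (∑-const c (allFinL q)) (cong (c *_) (length-tabulate id))

  ∑ₚ : (Point → ℕ) → ℕ
  ∑ₚ f = ∑ f allPoints

  ∑ₚ-charts : ∀ f → ∑ₚ f ≡ ∑ᶠ (λ y → ∑ᶠ (λ z → f (pt1 y z))) + (∑ᶠ (λ z → f (pt2 z)) + (f pt3 + 0))
  ∑ₚ-charts f = begin
    ∑ₚ f
      ≡⟨ ∑-++ f (List.concatMap (λ y → map (pt1 y) (allFinL q)) (allFinL q)) _ ⟩
    ∑ f (List.concatMap (λ y → map (pt1 y) (allFinL q)) (allFinL q)) + ∑ f (map pt2 (allFinL q) List.++ (pt3 ∷ []))
      ≡⟨ cong₂ _+_ (trans (∑-concatMap f _ (allFinL q)) (∑-cong (λ y → ∑-map f (pt1 y) (allFinL q)) (allFinL q)))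
                    (trans (∑-++ f (map pt2 (allFinL q)) (pt3 ∷ [])) (cong (_+ (f pt3 + 0)) (∑-map f pt2 (allFinL q)))) ⟩
    ∑ᶠ (λ y → ∑ᶠ (λ z → f (pt1 y z))) + (∑ᶠ (λ z → f (pt2 z)) + (f pt3 + 0)) ∎
    where open ≡-Reasoning

  #field : ∑ᶠ (λ _ → 1) ≡ q
  #field = trans (∑ᶠ-const 1) (*-identityˡ q)

  #points : ∑ₚ (λ _ → 1) ≡ q * q + (q + 1)
  #points = trans (∑ₚ-charts _) (cong₂ _+_ (trans (∑-cong (λ _ → #field) (allFinL q)) (∑ᶠ-const q)) (cong (_+ 1) #field))

  δ : Point → Point → Bool
  δ P X = does (X ≟P P)

  δ-refl : ∀ P → δ P P ≡ true
  δ-refl P = dec-true (P ≟P P) refl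

  ∑ₚ-δ : ∀ P → ∑ₚ (λ X → ⟦ δ P X ⟧) ≡ 1
  ∑ₚ-δ (pt1 y₀ z₀) = trans (∑ₚ-charts _) (cong₂ _+_ pt1-part (cong₂ _+_ (∑-zero _ (λ _ → refl) (allFinL q)) refl))
    where
    factor : ∀ y z → ⟦ δ (pt1 y₀ z₀) (pt1 y z) ⟧ ≡ ⟦ does (y ≟F y₀) ⟧ * ⟦ does (z ≟F z₀) ⟧
    factor y z with y ≟F y₀ | z ≟F z₀
    ... | yes refl | yes refl = refl
    ... | yes refl | no _ = refl
    ... | no _ | _ = refl
    pt1-part : ∑ᶠ (λ y → ∑ᶠ (λ z → ⟦ δ (pt1 y₀ z₀) (pt1 y z) ⟧)) ≡ 1
    pt1-part = begin
      ∑ᶠ (λ y → ∑ᶠ (λ z → ⟦ δ (pt1 y₀ z₀) (pt1 y z) ⟧))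
        ≡⟨ ∑-cong (λ y → trans (∑-cong (factor y) (allFinL q)) (∑-*ˡ ⟦ does (y ≟F y₀) ⟧ _ (allFinL q))) (allFinL q) ⟩
      ∑ᶠ (λ y → ⟦ does (y ≟F y₀) ⟧ * ∑ᶠ (λ z → ⟦ does (z ≟F z₀) ⟧))
        ≡⟨ ∑-cong (λ y → trans (cong (⟦ does (y ≟F y₀) ⟧ *_) (∑-δ-allFin z₀)) (*-identityʳ _)) (allFinL q) ⟩
      ∑ᶠ (λ y → ⟦ does (y ≟F y₀) ⟧)
        ≡⟨ ∑-δ-allFin y₀ ⟩
      1 ∎
      where open ≡-Reasoning
  ∑ₚ-δ (pt2 z₀) = trans (∑ₚ-charts _)
    (cong₂ _+_ (∑-zero _ (λ y → ∑-zero _ (λ _ → refl) (allFinL q)) (allFinL q))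
               (cong₂ _+_ (trans (∑-cong factor (allFinL q)) (∑-δ-allFin z₀)) refl))
    where
    factor : ∀ z → ⟦ δ (pt2 z₀) (pt2 z) ⟧ ≡ ⟦ does (z ≟F z₀) ⟧
    factor z with z ≟F z₀
    ... | yes refl = refl
    ... | no _ = refl
  ∑ₚ-δ pt3 = trans (∑ₚ-charts _)
    (cong₂ _+_ (∑-zero _ (λ y → ∑-zero _ (λ _ → refl) (allFinL q)) (allFinL q))
               (cong (_+ 1) (∑-zero _ (λ _ → refl) (allFinL q))))

  ∑ₚ-δ* : ∀ P (f : Point → ℕ) → ∑ₚ (λ X → ⟦ δ P X ⟧ * f X) ≡ f P
  ∑ₚ-δ* P f = begin
    ∑ₚ (λ X → ⟦ δ P X ⟧ * f X)   ≡⟨ ∑-cong sift allPoints ⟩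
    ∑ₚ (λ X → f P * ⟦ δ P X ⟧)   ≡⟨ ∑-*ˡ (f P) _ allPoints ⟩
    f P * ∑ₚ (λ X → ⟦ δ P X ⟧)   ≡⟨ cong (f P *_) (∑ₚ-δ P) ⟩
    f P * 1                      ≡⟨ *-identityʳ (f P) ⟩
    f P                          ∎
    where
    open ≡-Reasoning
    sift : ∀ X → ⟦ δ P X ⟧ * f X ≡ f P * ⟦ δ P X ⟧
    sift X with X ≟P P
    ... | yes refl = *-comm 1 (f X)
    ... | no _ = sym (*-zeroʳ (f P))

  term≤∑ₚ : ∀ P (f : Point → ℕ) → f P ≤ ∑ₚ f
  term≤∑ₚ P f = subst (_≤ ∑ₚ f) (∑ₚ-δ* P f) (∑-mono-≤ (λ X → ⟦⟧*n≤n (δ P X) (f X)) allPoints)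

  ∑ₚ-remove : ∀ (p : Point → Bool) P → p P ≡ true →
              ∑ₚ (λ X → ⟦ p X ⟧) ≡ 1 + ∑ₚ (λ X → ⟦ p X ∧ not (δ P X) ⟧)
  ∑ₚ-remove p P pP = begin
    ∑ₚ (λ X → ⟦ p X ⟧)                                 ≡⟨ ∑-cong split allPoints ⟩
    ∑ₚ (λ X → ⟦ δ P X ⟧ * ⟦ p X ⟧ + ⟦ p X ∧ not (δ P X) ⟧)  ≡⟨ ∑-+ _ _ allPoints ⟩
    ∑ₚ (λ X → ⟦ δ P X ⟧ * ⟦ p X ⟧) + rest              ≡⟨ cong (_+ rest) (∑ₚ-δ* P (λ X → ⟦ p X ⟧)) ⟩
    ⟦ p P ⟧ + rest                                     ≡⟨ cong (λ b → ⟦ b ⟧ + rest) pP ⟩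
    1 + rest                                           ∎
    where
    open ≡-Reasoning
    rest = ∑ₚ (λ X → ⟦ p X ∧ not (δ P X) ⟧)
    split : ∀ X → ⟦ p X ⟧ ≡ ⟦ δ P X ⟧ * ⟦ p X ⟧ + ⟦ p X ∧ not (δ P X) ⟧
    split X with δ P X | p X
    ... | true | true = refl
    ... | true | false = refl
    ... | false | true = refl
    ... | false | false = refl

  ∑ₚ-pick : ∀ (p : Point → Bool) n → suc n ≤ ∑ₚ (λ X → ⟦ p X ⟧) →
            Σ Point λ P → (p P ≡ true) × (n ≤ ∑ₚ (λ X → ⟦ p X ∧ not (δ P X) ⟧))
  ∑ₚ-pick p n n<∑ =
    let P , pP = ∑-witness p allPoints (≤-trans (s≤s z≤n) n<∑)
    in P , pP , s≤s⁻¹ (subst (suc n ≤_) (∑ₚ-remove p P pP) n<∑)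

  δ-false : ∀ {P X} → not (δ P X) ≡ true → X ≢ P
  δ-false {P} ¬δ refl = true≢false (trans (sym ¬δ) (cong not (δ-refl P)))

  ThreeDistinct : (Point → Bool) → Set
  ThreeDistinct p = Σ Point λ X₁ → Σ Point λ X₂ → Σ Point λ X₃ →
    (p X₁ ≡ true) × (p X₂ ≡ true) × (p X₃ ≡ true) × (X₁ ≢ X₂) × (X₁ ≢ X₃) × (X₂ ≢ X₃)

  three-distinct : ∀ (p : Point → Bool) → 3 ≤ ∑ₚ (λ X → ⟦ p X ⟧) → ThreeDistinct p
  three-distinct p 3≤∑ =
    let X₁ , pX₁ , 2≤rest₁ = ∑ₚ-pick p 2 3≤∑
        X₂ , p₁X₂ , 1≤rest₂ = ∑ₚ-pick (λ X → p X ∧ not (δ X₁ X)) 1 2≤rest₁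
        X₃ , p₂X₃ , _ = ∑ₚ-pick (λ X → (p X ∧ not (δ X₁ X)) ∧ not (δ X₂ X)) 0 1≤rest₂
        pX₂ , X₂≢X₁ = ∧-elim p₁X₂
        p₁X₃ , X₃≢X₂ = ∧-elim p₂X₃
        pX₃ , X₃≢X₁ = ∧-elim p₁X₃
    in X₁ , X₂ , X₃ , pX₁ , pX₂ , pX₃ ,
       (λ e → δ-false X₂≢X₁ (sym e)) , (λ e → δ-false X₃≢X₁ (sym e)) , (λ e → δ-false X₃≢X₂ (sym e))

  linesThrough : Point → ℕ
  linesThrough P = ∑ₚ λ ℓ → ⟦ inc P ℓ ⟧

  pointsOn : Line → ℕ
  pointsOn ℓ = ∑ₚ λ X → ⟦ inc X ℓ ⟧

  pointsOn≡linesThrough : ∀ ℓ → pointsOn ℓ ≡ linesThrough ℓ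
  pointsOn≡linesThrough ℓ = ∑-cong (λ X → cong ⟦_⟧ (inc-sym X ℓ)) allPoints

  commonLines : Point → Point → ℕ
  commonLines P Q = ∑ₚ λ ℓ → ⟦ inc P ℓ ⟧ * ⟦ inc Q ℓ ⟧

  commonLines-self : ∀ P → commonLines P P ≡ linesThrough P
  commonLines-self P = ∑-cong (λ ℓ → ⟦⟧-idem (inc P ℓ)) allPoints

  ⟦P,Q∈ℓ⟧≡δ : ∀ P Q ℓ₀ → P ≢ Q → inc P ℓ₀ ≡ true → inc Q ℓ₀ ≡ true →
              ∀ ℓ → ⟦ inc P ℓ ⟧ * ⟦ inc Q ℓ ⟧ ≡ ⟦ δ ℓ₀ ℓ ⟧
  ⟦P,Q∈ℓ⟧≡δ P Q ℓ₀ P≢Q P∈ℓ₀ Q∈ℓ₀ ℓ with ℓ ≟P ℓ₀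
  ... | yes refl rewrite P∈ℓ₀ | Q∈ℓ₀ = refl
  ... | no ℓ≢ℓ₀ with inc P ℓ in P∈ℓ | inc Q ℓ in Q∈ℓ
  ...   | true | true = ⊥-elim (ℓ≢ℓ₀ (line-unique P Q ℓ ℓ₀ P≢Q P∈ℓ Q∈ℓ P∈ℓ₀ Q∈ℓ₀))
  ...   | true | false = refl
  ...   | false | _ = refl

  commonLines-≢ : ∀ P Q → P ≢ Q → commonLines P Q ≡ 1
  commonLines-≢ P Q P≢Q =
    let ℓ₀ , P∈ℓ₀ , Q∈ℓ₀ = line-through P Q P≢Q
    in trans (∑-cong (⟦P,Q∈ℓ⟧≡δ P Q ℓ₀ P≢Q P∈ℓ₀ Q∈ℓ₀) allPoints) (∑ₚ-δ ℓ₀)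

  -- Projection from P: each point of m lies on exactly one line through P, and each line
  -- through P meets m at most once.
  pointsOn≤linesThrough : ∀ P m → inc P m ≡ false → pointsOn m ≤ linesThrough P
  pointsOn≤linesThrough P m P∉m = begin
    ∑ₚ (λ X → ⟦ inc X m ⟧)
      ≡⟨ ∑-cong (λ X → sym (join X)) allPoints ⟩
    ∑ₚ (λ X → ⟦ inc X m ⟧ * commonLines P X)
      ≡⟨ ∑-cong (λ X → sym (∑-*ˡ ⟦ inc X m ⟧ _ allPoints)) allPoints ⟩
    ∑ₚ (λ X → ∑ₚ (λ ℓ → ⟦ inc X m ⟧ * (⟦ inc P ℓ ⟧ * ⟦ inc X ℓ ⟧)))
      ≡⟨ ∑-comm _ allPoints allPoints ⟩
    ∑ₚ (λ ℓ → ∑ₚ (λ X → ⟦ inc X m ⟧ * (⟦ inc P ℓ ⟧ * ⟦ inc X ℓ ⟧)))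
      ≡⟨ ∑-cong (λ ℓ → trans (∑-cong (dualise ℓ) allPoints) (∑-*ˡ ⟦ inc P ℓ ⟧ _ allPoints)) allPoints ⟩
    ∑ₚ (λ ℓ → ⟦ inc P ℓ ⟧ * commonLines ℓ m)
      ≤⟨ ∑-mono-≤ meets-m-once allPoints ⟩
    ∑ₚ (λ ℓ → ⟦ inc P ℓ ⟧) ∎
    where
    open ≤-Reasoning
    join : ∀ X → ⟦ inc X m ⟧ * commonLines P X ≡ ⟦ inc X m ⟧
    join X = ⟦⟧*-when (inc X m) λ X∈m →
      commonLines-≢ P X λ { refl → true≢false (trans (sym X∈m) P∉m) }
    dualise : ∀ ℓ X →
              ⟦ inc X m ⟧ * (⟦ inc P ℓ ⟧ * ⟦ inc X ℓ ⟧) ≡ ⟦ inc P ℓ ⟧ * (⟦ inc ℓ X ⟧ * ⟦ inc m X ⟧)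
    dualise ℓ X = trans (rearrange ⟦ inc X m ⟧ ⟦ inc P ℓ ⟧ ⟦ inc X ℓ ⟧)
      (cong₂ (λ a b → ⟦ inc P ℓ ⟧ * (⟦ a ⟧ * ⟦ b ⟧)) (inc-sym X ℓ) (inc-sym X m))
      where
      rearrange : ∀ a b c → a * (b * c) ≡ b * (c * a)
      rearrange = solve-∀
    meets-m-once : ∀ ℓ → ⟦ inc P ℓ ⟧ * commonLines ℓ m ≤ ⟦ inc P ℓ ⟧
    meets-m-once ℓ = ≤-reflexive
      (⟦⟧*-when (inc P ℓ) λ P∈ℓ → commonLines-≢ ℓ m λ { refl → true≢false (trans (sym P∈ℓ) P∉m) })

  linesThrough-≤ : ∀ P m → inc P m ≡ false → linesThrough m ≤ linesThrough P
  linesThrough-≤ P m P∉m = subst (_≤ linesThrough P) (pointsOn≡linesThrough m) (pointsOn≤linesThrough P m P∉m)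

  q+1≤linesThrough-pt3 : q + 1 ≤ linesThrough pt3
  q+1≤linesThrough-pt3 = begin
    q + 1
      ≡⟨ cong (_+ 1) #field ⟨
    ∑ᶠ (λ _ → 1) + 1
      ≤⟨ +-mono-≤ (∑-mono-≤ (λ y → one-line {pt1 y} (pt3∈pt1[y,0] y)) (allFinL q))
                  (≤-trans (one-line {pt2} pt3∈pt2[0]) (m≤m+n _ _)) ⟩
    ∑ᶠ (λ y → ∑ᶠ (λ z → ⟦ inc pt3 (pt1 y z) ⟧)) + (∑ᶠ (λ z → ⟦ inc pt3 (pt2 z) ⟧) + (⟦ inc pt3 pt3 ⟧ + 0))
      ≡⟨ ∑ₚ-charts _ ⟨
    linesThrough pt3 ∎
    where
    open ≤-Reasoning
    one-line : ∀ {ℓ : Fin q → Line} → inc pt3 (ℓ 0F) ≡ true → 1 ≤ ∑ᶠ (λ z → ⟦ inc pt3 (ℓ z) ⟧)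
    one-line {ℓ} pt3∈ℓ₀ =
      subst (λ b → ⟦ b ⟧ ≤ ∑ᶠ (λ z → ⟦ inc pt3 (ℓ z) ⟧)) pt3∈ℓ₀
        (term≤∑ (λ z → ⟦ inc pt3 (ℓ z) ⟧) (∈-allFin 0F))

  q+1≤linesThrough : ∀ P → q + 1 ≤ linesThrough P
  q+1≤linesThrough P = by-cases (inc P pt3) refl
    where
    by-cases : ∀ b → inc P pt3 ≡ b → q + 1 ≤ linesThrough P
    by-cases false P∉pt3 = ≤-trans q+1≤linesThrough-pt3 (linesThrough-≤ P pt3 P∉pt3)
    by-cases true P∈pt3 =
      let m , P∉m , m∉pt3 = line-avoiding P P∈pt3
      in ≤-trans q+1≤linesThrough-pt3 (≤-trans (linesThrough-≤ m pt3 m∉pt3) (linesThrough-≤ P m P∉m))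

module DisjointLines {q : ℕ} (F : FiniteField q) where

  open import Data.Nat using (zero; suc; _+_; _*_; _∸_; _≤_; z≤n; s≤s)
  open import Data.Nat.Properties
  open import Data.Fin using (Fin)
  open import Data.Fin.Properties using (toℕ<n)
  open import Data.Bool using (true; false; _∧_)
  open import Relation.Nullary using (Dec; yes; no; does)
  open import Relation.Binary.PropositionalEquality
  open import Data.Nat.Tactic.RingSolver using (solve-∀)

  open FiniteField F using (0F)
  open PG F
  open Sums
  open LineCounts F

  meet≡∑ : ∀ D ℓ → meet D ℓ ≡ ∑ₚ (λ X → ⟦ D X ∧ inc X ℓ ⟧)
  meet≡∑ D ℓ = count≡∑ _ allPoints

  ∣∣≡∑ : ∀ D → ∣ D ∣ ≡ ∑ₚ (λ X → ⟦ D X ⟧)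
  ∣∣≡∑ D = count≡∑ D allPoints

  -- Double counting of the flags (X, ℓ) with X ∈ D on ℓ, each weighted by w ℓ.
  ∑-meet : ∀ D (w : Line → ℕ) →
           ∑ₚ (λ ℓ → w ℓ * meet D ℓ) ≡ ∑ₚ (λ X → ⟦ D X ⟧ * ∑ₚ (λ ℓ → ⟦ inc X ℓ ⟧ * w ℓ))
  ∑-meet D w = begin
    ∑ₚ (λ ℓ → w ℓ * meet D ℓ)
      ≡⟨ ∑-cong (λ ℓ → trans (cong (w ℓ *_) (meet≡∑ D ℓ)) (sym (∑-*ˡ (w ℓ) _ allPoints))) allPoints ⟩
    ∑ₚ (λ ℓ → ∑ₚ (λ X → w ℓ * ⟦ D X ∧ inc X ℓ ⟧))
      ≡⟨ ∑-comm _ allPoints allPoints ⟩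
    ∑ₚ (λ X → ∑ₚ (λ ℓ → w ℓ * ⟦ D X ∧ inc X ℓ ⟧))
      ≡⟨ ∑-cong (λ X → trans (∑-cong (flag X) allPoints) (∑-*ˡ ⟦ D X ⟧ _ allPoints)) allPoints ⟩
    ∑ₚ (λ X → ⟦ D X ⟧ * ∑ₚ (λ ℓ → ⟦ inc X ℓ ⟧ * w ℓ)) ∎
    where
    open ≡-Reasoning
    flag : ∀ X ℓ → w ℓ * ⟦ D X ∧ inc X ℓ ⟧ ≡ ⟦ D X ⟧ * (⟦ inc X ℓ ⟧ * w ℓ)
    flag X ℓ = trans (cong (w ℓ *_) (⟦∧⟧ (D X) (inc X ℓ))) (rearrange (w ℓ) ⟦ D X ⟧ ⟦ inc X ℓ ⟧)
      where
      rearrange : ∀ a b c → a * (b * c) ≡ b * (c * a)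
      rearrange = solve-∀

  ∑-meet-through : ∀ D X → ∑ₚ (λ ℓ → ⟦ inc X ℓ ⟧ * meet D ℓ) ≡ ∑ₚ (λ Y → ⟦ D Y ⟧ * commonLines Y X)
  ∑-meet-through D X = ∑-meet D (λ ℓ → ⟦ inc X ℓ ⟧)

  module _ (D : PointSet) where

    ∑meet : ∑ₚ (meet D) ≡ ∑ₚ (λ X → ⟦ D X ⟧ * linesThrough X)
    ∑meet = trans (∑-cong (λ ℓ → sym (*-identityˡ (meet D ℓ))) allPoints)
           (trans (∑-meet D (λ _ → 1))
                  (∑-cong (λ X → cong (⟦ D X ⟧ *_) (∑-cong (λ ℓ → *-identityʳ _) allPoints)) allPoints))

    [q+1]∣D∣≤∑meet : (q + 1) * ∣ D ∣ ≤ ∑ₚ (meet D)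
    [q+1]∣D∣≤∑meet = begin
      (q + 1) * ∣ D ∣                       ≡⟨ cong ((q + 1) *_) (∣∣≡∑ D) ⟩
      (q + 1) * ∑ₚ (λ X → ⟦ D X ⟧)          ≡⟨ ∑-*ˡ (q + 1) _ allPoints ⟨
      ∑ₚ (λ X → (q + 1) * ⟦ D X ⟧)          ≤⟨ ∑-mono-≤ (λ X → ≤-trans (≤-reflexive (*-comm (q + 1) ⟦ D X ⟧))
                                                 (*-monoʳ-≤ ⟦ D X ⟧ (q+1≤linesThrough X))) allPoints ⟩
      ∑ₚ (λ X → ⟦ D X ⟧ * linesThrough X)   ≡⟨ ∑meet ⟨
      ∑ₚ (meet D)                           ∎
      where open ≤-Reasoning

    ∑commonLines : ∀ X → ∑ₚ (λ Y → ⟦ D Y ⟧ * commonLines Y X) + ⟦ D X ⟧ ≡ ⟦ D X ⟧ * linesThrough X + ∣ D ∣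
    ∑commonLines X = begin
      ∑ₚ (λ Y → ⟦ D Y ⟧ * commonLines Y X) + ⟦ D X ⟧
        ≡⟨ cong (∑ₚ (λ Y → ⟦ D Y ⟧ * commonLines Y X) +_) (∑ₚ-δ* X (λ Y → ⟦ D Y ⟧)) ⟨
      ∑ₚ (λ Y → ⟦ D Y ⟧ * commonLines Y X) + ∑ₚ (λ Y → ⟦ δ X Y ⟧ * ⟦ D Y ⟧)
        ≡⟨ ∑-+ _ _ allPoints ⟨
      ∑ₚ (λ Y → ⟦ D Y ⟧ * commonLines Y X + ⟦ δ X Y ⟧ * ⟦ D Y ⟧)
        ≡⟨ ∑-cong (λ Y → by-cases Y (Y ≟P X)) allPoints ⟩
      ∑ₚ (λ Y → ⟦ δ X Y ⟧ * (⟦ D Y ⟧ * linesThrough X) + ⟦ D Y ⟧)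
        ≡⟨ ∑-+ _ _ allPoints ⟩
      ∑ₚ (λ Y → ⟦ δ X Y ⟧ * (⟦ D Y ⟧ * linesThrough X)) + ∑ₚ (λ Y → ⟦ D Y ⟧)
        ≡⟨ cong₂ _+_ (∑ₚ-δ* X (λ Y → ⟦ D Y ⟧ * linesThrough X)) (sym (∣∣≡∑ D)) ⟩
      ⟦ D X ⟧ * linesThrough X + ∣ D ∣ ∎
      where
      open ≡-Reasoning
      by-cases : ∀ Y (Y≟X : Dec (Y ≡ X)) →
                 ⟦ D Y ⟧ * commonLines Y X + ⟦ does Y≟X ⟧ * ⟦ D Y ⟧ ≡
                 ⟦ does Y≟X ⟧ * (⟦ D Y ⟧ * linesThrough X) + ⟦ D Y ⟧
      by-cases Y (yes refl) = cong₂ _+_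
        (trans (cong (⟦ D Y ⟧ *_) (commonLines-self Y)) (sym (*-identityˡ _))) (*-identityˡ _)
      by-cases Y (no Y≢X) =
        trans (+-identityʳ _) (trans (cong (⟦ D Y ⟧ *_) (commonLines-≢ Y X Y≢X)) (*-identityʳ _))

    -- meet D ℓ ² counts ordered pairs of points of D on ℓ, and distinct points share exactly one line.
    ∑meet² : ∑ₚ (λ ℓ → meet D ℓ * meet D ℓ) + ∣ D ∣ ≡ ∑ₚ (meet D) + ∣ D ∣ * ∣ D ∣
    ∑meet² = begin
      ∑ₚ (λ ℓ → meet D ℓ * meet D ℓ) + ∣ D ∣
        ≡⟨ cong₂ _+_ (∑-meet D (meet D)) (∣∣≡∑ D) ⟩
      ∑ₚ (λ X → ⟦ D X ⟧ * ∑ₚ (λ ℓ → ⟦ inc X ℓ ⟧ * meet D ℓ)) + ∑ₚ (λ X → ⟦ D X ⟧)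
        ≡⟨ ∑-+ _ _ allPoints ⟨
      ∑ₚ (λ X → ⟦ D X ⟧ * ∑ₚ (λ ℓ → ⟦ inc X ℓ ⟧ * meet D ℓ) + ⟦ D X ⟧)
        ≡⟨ ∑-cong per-point allPoints ⟩
      ∑ₚ (λ X → ⟦ D X ⟧ * linesThrough X + ∣ D ∣ * ⟦ D X ⟧)
        ≡⟨ ∑-+ _ _ allPoints ⟩
      ∑ₚ (λ X → ⟦ D X ⟧ * linesThrough X) + ∑ₚ (λ X → ∣ D ∣ * ⟦ D X ⟧)
        ≡⟨ cong₂ _+_ (sym ∑meet) (trans (∑-*ˡ ∣ D ∣ _ allPoints) (cong (∣ D ∣ *_) (sym (∣∣≡∑ D)))) ⟩
      ∑ₚ (meet D) + ∣ D ∣ * ∣ D ∣ ∎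
      where
      open ≡-Reasoning
      absorb : ∀ b t n → ⟦ b ⟧ * (⟦ b ⟧ * t + n) ≡ ⟦ b ⟧ * t + n * ⟦ b ⟧
      absorb true t n = trans (+-identityʳ (1 * t + n)) (cong₂ _+_ refl (sym (*-identityʳ n)))
      absorb false t n = sym (*-zeroʳ n)
      per-point : ∀ X → ⟦ D X ⟧ * ∑ₚ (λ ℓ → ⟦ inc X ℓ ⟧ * meet D ℓ) + ⟦ D X ⟧ ≡
                        ⟦ D X ⟧ * linesThrough X + ∣ D ∣ * ⟦ D X ⟧
      per-point X = begin
        ⟦ D X ⟧ * ∑ₚ (λ ℓ → ⟦ inc X ℓ ⟧ * meet D ℓ) + ⟦ D X ⟧
          ≡⟨ cong₂ _+_ (cong (⟦ D X ⟧ *_) (∑-meet-through D X)) (sym (⟦⟧-idem (D X))) ⟩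
        ⟦ D X ⟧ * ∑ₚ (λ Y → ⟦ D Y ⟧ * commonLines Y X) + ⟦ D X ⟧ * ⟦ D X ⟧
          ≡⟨ *-distribˡ-+ ⟦ D X ⟧ _ _ ⟨
        ⟦ D X ⟧ * (∑ₚ (λ Y → ⟦ D Y ⟧ * commonLines Y X) + ⟦ D X ⟧)
          ≡⟨ cong (⟦ D X ⟧ *_) (∑commonLines X) ⟩
        ⟦ D X ⟧ * (⟦ D X ⟧ * linesThrough X + ∣ D ∣)
          ≡⟨ absorb (D X) (linesThrough X) ∣ D ∣ ⟩
        ⟦ D X ⟧ * linesThrough X + ∣ D ∣ * ⟦ D X ⟧ ∎

  -- Truncated subtraction makes (i ∸ 1) * (i ∸ 2) vanish at i = 0, where the term
  -- counting disjoint lines takes over.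
  per-line : ∀ i → 2 * ⟦ i ≡ᵇ 0 ⟧ + 3 * i + (i ∸ 1) * (i ∸ 2) ≡ 2 + i * i
  per-line zero = refl
  per-line (suc zero) = refl
  per-line (suc (suc r)) = identity r
    where
    identity : ∀ r → 0 + 3 * suc (suc r) + suc r * r ≡ 2 + suc (suc r) * suc (suc r)
    identity = solve-∀

  excess : PointSet → ℕ
  excess S = ∑ₚ λ ℓ → (meet S ℓ ∸ 1) * (meet S ℓ ∸ 2)

  u₀-identity : ∀ S → 2 * u₀ S + 3 * ∑ₚ (meet S) + excess S ≡
                      2 * (q * q + (q + 1)) + ∑ₚ (λ ℓ → meet S ℓ * meet S ℓ)
  u₀-identity S = begin
    2 * u₀ S + 3 * ∑ₚ (meet S) + excess S
      ≡⟨ cong (λ u → 2 * u + 3 * ∑ₚ (meet S) + excess S) (count≡∑ _ allPoints) ⟩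
    2 * ∑ₚ (λ ℓ → ⟦ meet S ℓ ≡ᵇ 0 ⟧) + 3 * ∑ₚ (meet S) + excess S
      ≡⟨ cong₂ (λ a b → a + b + excess S) (∑-*ˡ 2 _ allPoints) (∑-*ˡ 3 _ allPoints) ⟨
    ∑ₚ (λ ℓ → 2 * ⟦ meet S ℓ ≡ᵇ 0 ⟧) + ∑ₚ (λ ℓ → 3 * meet S ℓ) + excess S
      ≡⟨ cong (_+ excess S) (∑-+ (λ ℓ → 2 * ⟦ meet S ℓ ≡ᵇ 0 ⟧) (λ ℓ → 3 * meet S ℓ) allPoints) ⟨
    ∑ₚ (λ ℓ → 2 * ⟦ meet S ℓ ≡ᵇ 0 ⟧ + 3 * meet S ℓ) + excess S
      ≡⟨ ∑-+ (λ ℓ → 2 * ⟦ meet S ℓ ≡ᵇ 0 ⟧ + 3 * meet S ℓ) (λ ℓ → (meet S ℓ ∸ 1) * (meet S ℓ ∸ 2))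
             allPoints ⟨
    ∑ₚ (λ ℓ → 2 * ⟦ meet S ℓ ≡ᵇ 0 ⟧ + 3 * meet S ℓ + (meet S ℓ ∸ 1) * (meet S ℓ ∸ 2))
      ≡⟨ ∑-cong (λ ℓ → per-line (meet S ℓ)) allPoints ⟩
    ∑ₚ (λ ℓ → 2 + meet S ℓ * meet S ℓ)
      ≡⟨ ∑-+ _ _ allPoints ⟩
    ∑ₚ (λ _ → 2) + ∑ₚ (λ ℓ → meet S ℓ * meet S ℓ)
      ≡⟨ cong (_+ ∑ₚ (λ ℓ → meet S ℓ * meet S ℓ))
           (trans (∑-cong (λ _ → sym (*-identityʳ 2)) allPoints) (trans (∑-*ˡ 2 _ allPoints) (cong (2 *_) #points))) ⟩
    2 * (q * q + (q + 1)) + ∑ₚ (λ ℓ → meet S ℓ * meet S ℓ) ∎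
    where open ≡-Reasoning

  u₀-arithmetic : ∀ q x a b → 1 ≤ q →
    x + 3 * a ≡ 2 * (q * q + (q + 1)) + b →
    b + (q + 1) ≡ a + (q + 1) * (q + 1) →
    (q + 1) * (q + 1) ≤ a →
    x ≤ q * (q ∸ 1)
  u₀-arithmetic (suc r) x a b _ identity squares lower = +-cancelˡ-≤ K x (suc r * r) (begin
    K + x                     ≡⟨ +-comm K x ⟩
    x + (2 * (s * s) + s)     ≤⟨ +-monoʳ-≤ x (+-monoˡ-≤ s (*-monoʳ-≤ 2 lower)) ⟩
    x + (2 * a + s)           ≡⟨ +-cancelʳ-≡ a _ _ (begin-equality
        x + (2 * a + s) + a   ≡⟨ shuffle x a s ⟩
        x + 3 * a + s         ≡⟨ cong (_+ s) identity ⟩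
        N + b + s             ≡⟨ +-assoc N b s ⟩
        N + (b + s)           ≡⟨ cong (N +_) squares ⟩
        N + (a + s * s)       ≡⟨ shuffle′ N a (s * s) ⟩
        N + s * s + a         ∎) ⟩
    N + s * s                 ≡⟨ expand r ⟩
    K + suc r * r             ∎)
    where
    open ≤-Reasoning
    s = suc r + 1
    N = 2 * (suc r * suc r + s)
    K = 2 * (s * s) + s
    shuffle : ∀ x a s → x + (2 * a + s) + a ≡ x + 3 * a + s
    shuffle = solve-∀
    shuffle′ : ∀ n a t → n + (a + t) ≡ n + t + a
    shuffle′ = solve-∀
    expand : ∀ r → 2 * (suc r * suc r + (suc r + 1)) + (suc r + 1) * (suc r + 1) ≡
                   2 * ((suc r + 1) * (suc r + 1)) + (suc r + 1) + suc r * r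
    expand = solve-∀

  u₀-bound : ∀ S → ∣ S ∣ ≡ q + 1 → 2 * u₀ S + excess S ≤ q * (q ∸ 1)
  u₀-bound S ∣S∣≡q+1 = u₀-arithmetic q (2 * u₀ S + excess S) (∑ₚ (meet S)) (∑ₚ (λ ℓ → meet S ℓ * meet S ℓ))
    1≤q
    (trans (shuffle (2 * u₀ S) (excess S) (∑ₚ (meet S))) (u₀-identity S))
    (subst (λ n → ∑ₚ (λ ℓ → meet S ℓ * meet S ℓ) + n ≡ ∑ₚ (meet S) + n * n) ∣S∣≡q+1 (∑meet² S))
    (subst (λ n → (q + 1) * n ≤ ∑ₚ (meet S)) ∣S∣≡q+1 ([q+1]∣D∣≤∑meet S))
    where
    shuffle : ∀ u e a → u + e + 3 * a ≡ u + 3 * a + e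
    shuffle = solve-∀
    1≤q : 1 ≤ q
    1≤q = ≤-trans (s≤s z≤n) (toℕ<n 0F)

module Arcs {q : ℕ} (F : FiniteField q) where

  open import Data.Nat using (zero; suc; _+_; _*_; _∸_; _≤_; z≤n; s≤s; _≤?_)
  open import Data.Nat.Properties hiding (≡ᵇ⇒≡; ≡⇒≡ᵇ)
  open import Data.Product using (_×_; _,_; proj₁; proj₂)
  open import Data.Sum using (_⊎_; inj₁; inj₂)
  open import Data.Empty using (⊥-elim)
  open import Data.Bool using (Bool; true; false; _∧_; not)
  open import Data.Bool.Properties using (∧-identityʳ)
  open import Relation.Nullary using (¬_; yes)
  open import Relation.Nullary.Decidable using (decidable-stable; dec-false)
  open import Relation.Binary.PropositionalEquality
  open import Data.Nat.Tactic.RingSolver using (solve-∀)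

  open PG F
  open Sums
  open LineCounts F
  open DisjointLines F

  ≡ᵇ⇒≡ : ∀ m n → (m ≡ᵇ n) ≡ true → m ≡ n
  ≡ᵇ⇒≡ zero zero _ = refl
  ≡ᵇ⇒≡ (suc m) (suc n) m≡ᵇn = cong suc (≡ᵇ⇒≡ m n m≡ᵇn)

  ≡⇒≡ᵇ : ∀ m n → m ≡ n → (m ≡ᵇ n) ≡ true
  ≡⇒≡ᵇ zero zero _ = refl
  ≡⇒≡ᵇ (suc m) (suc n) refl = ≡⇒≡ᵇ m n refl

  _∖_ : PointSet → PointSet → PointSet
  (S ∖ A) X = S X ∧ not (A X)

  ∑-∖ : ∀ {S A} → A ⊆ S → ∀ (r : Point → Bool) →
        ∑ₚ (λ X → ⟦ S X ∧ r X ⟧) ≡ ∑ₚ (λ X → ⟦ A X ∧ r X ⟧) + ∑ₚ (λ X → ⟦ (S ∖ A) X ∧ r X ⟧)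
  ∑-∖ {S} {A} A⊆S r = trans (∑-cong split allPoints) (∑-+ _ _ allPoints)
    where
    split : ∀ X → ⟦ S X ∧ r X ⟧ ≡ ⟦ A X ∧ r X ⟧ + ⟦ (S ∖ A) X ∧ r X ⟧
    split X with A X in X∈A | S X in X∈S
    ... | true | true = sym (+-identityʳ _)
    ... | true | false = ⊥-elim (true≢false (trans (sym (A⊆S X X∈A)) X∈S))
    ... | false | true = refl
    ... | false | false = refl

  meet-∖ : ∀ {S A} → A ⊆ S → ∀ ℓ → meet S ℓ ≡ meet A ℓ + meet (S ∖ A) ℓ
  meet-∖ {S} {A} A⊆S ℓ = trans (meet≡∑ S ℓ) (trans (∑-∖ A⊆S (λ X → inc X ℓ))
    (sym (cong₂ _+_ (meet≡∑ A ℓ) (meet≡∑ (S ∖ A) ℓ))))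

  ∣∣-∖ : ∀ {S A} → A ⊆ S → ∣ S ∣ ≡ ∣ A ∣ + ∣ S ∖ A ∣
  ∣∣-∖ {S} {A} A⊆S = begin
    ∣ S ∣                                             ≡⟨ ∣∣≡∑ S ⟩
    ∑ₚ (λ X → ⟦ S X ⟧)                             ≡⟨ ∑-cong (λ X → cong ⟦_⟧ (∧-identityʳ (S X))) allPoints ⟨
    ∑ₚ (λ X → ⟦ S X ∧ true ⟧)                         ≡⟨ ∑-∖ A⊆S (λ _ → true) ⟩
    ∑ₚ (λ X → ⟦ A X ∧ true ⟧) + ∑ₚ (λ X → ⟦ (S ∖ A) X ∧ true ⟧)
      ≡⟨ cong₂ _+_ (∑-cong (λ X → cong ⟦_⟧ (∧-identityʳ (A X))) allPoints)
                   (∑-cong (λ X → cong ⟦_⟧ (∧-identityʳ ((S ∖ A) X))) allPoints) ⟩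
    ∑ₚ (λ X → ⟦ A X ⟧) + ∑ₚ (λ X → ⟦ (S ∖ A) X ⟧)    ≡⟨ cong₂ _+_ (∣∣≡∑ A) (∣∣≡∑ (S ∖ A)) ⟨
    ∣ A ∣ + ∣ S ∖ A ∣                                 ∎
    where open ≡-Reasoning

  ∈-∪｛｝ : ∀ A {P X} → (A ∪｛ P ｝) X ≡ true → (X ∈ A) ⊎ (X ≡ P)
  ∈-∪｛｝ A {P} {X} X∈ with A X | X ≟P P
  ... | true | _ = inj₁ refl
  ... | false | yes X≡P = inj₂ X≡P

  secant : PointSet → Line → Bool
  secant A ℓ = meet A ℓ ≡ᵇ 2

  secantsThrough≡∑ : ∀ A X → secantsThrough A X ≡ ∑ₚ (λ ℓ → ⟦ inc X ℓ ⟧ * ⟦ secant A ℓ ⟧)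
  secantsThrough≡∑ A X = trans (count≡∑ _ allPoints) (∑-cong (λ ℓ → ⟦∧⟧ (inc X ℓ) (secant A ℓ)) allPoints)

  tangentsThrough≡∑ : ∀ A X → tangentsThrough A X ≡ ∑ₚ (λ ℓ → ⟦ inc X ℓ ⟧ * ⟦ meet A ℓ ≡ᵇ 1 ⟧)
  tangentsThrough≡∑ A X = trans (count≡∑ _ allPoints) (∑-cong (λ ℓ → ⟦∧⟧ (inc X ℓ) (meet A ℓ ≡ᵇ 1)) allPoints)

  ∑secantsThrough : ∀ A D →
                    ∑ₚ (λ X → ⟦ D X ⟧ * secantsThrough A X) ≡ ∑ₚ (λ ℓ → ⟦ secant A ℓ ⟧ * meet D ℓ)
  ∑secantsThrough A D = trans (∑-cong (λ X → cong (⟦ D X ⟧ *_) (secantsThrough≡∑ A X)) allPoints)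
                              (sym (∑-meet D (λ ℓ → ⟦ secant A ℓ ⟧)))

  module _ {A : PointSet} (arc : IsArc A) where

    ¬three-collinear : ∀ ℓ → ¬ ThreeDistinct (λ X → A X ∧ inc X ℓ)
    ¬three-collinear ℓ (X₁ , X₂ , X₃ , on₁ , on₂ , on₃ , X₁≢X₂ , X₁≢X₃ , X₂≢X₃) =
      arc X₁ X₂ X₃ (proj₁ (∧-elim on₁)) (proj₁ (∧-elim on₂)) (proj₁ (∧-elim on₃)) X₁≢X₂ X₁≢X₃ X₂≢X₃
        (ℓ , proj₂ (∧-elim on₁) , proj₂ (∧-elim on₂) , proj₂ (∧-elim on₃))

    meet≤2 : ∀ ℓ → meet A ℓ ≤ 2
    meet≤2 ℓ = decidable-stable (meet A ℓ ≤? 2) λ meet≰2 →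
      ¬three-collinear ℓ (three-distinct (λ X → A X ∧ inc X ℓ) (subst (3 ≤_) (meet≡∑ A ℓ) (≰⇒> meet≰2)))

    secant-through : ∀ ℓ {Q R} → Q ≢ R → Q ∈ A → R ∈ A →
                     inc Q ℓ ≡ true → inc R ℓ ≡ true → secant A ℓ ≡ true
    secant-through ℓ {Q} {R} Q≢R Q∈A R∈A Q∈ℓ R∈ℓ = ≡⇒≡ᵇ (meet A ℓ) 2 (≤-antisym (meet≤2 ℓ) (begin
      2                              ≤⟨ s≤s (subst (λ b → ⟦ b ⟧ ≤ rest) R∈rest (term≤∑ₚ R _)) ⟩
      1 + rest                       ≡⟨ ∑ₚ-remove (λ X → A X ∧ inc X ℓ) Q (∧-intro Q∈A Q∈ℓ) ⟨
      ∑ₚ (λ X → ⟦ A X ∧ inc X ℓ ⟧)   ≡⟨ meet≡∑ A ℓ ⟨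
      meet A ℓ                       ∎))
      where
      open ≤-Reasoning
      rest = ∑ₚ (λ X → ⟦ (A X ∧ inc X ℓ) ∧ not (δ Q X) ⟧)
      R∈rest : (A R ∧ inc R ℓ) ∧ not (δ Q R) ≡ true
      R∈rest = ∧-intro (∧-intro R∈A R∈ℓ) (cong not (dec-false (R ≟P Q) (λ R≡Q → Q≢R (sym R≡Q))))

    -- Each point of A lies on exactly one line through X, and such a line meets A in one or two points.
    ∣A∣≤tangents+2secants : ∀ X → X ∉ A → ∣ A ∣ ≤ tangentsThrough A X + 2 * secantsThrough A X
    ∣A∣≤tangents+2secants X X∉A = begin
      ∣ A ∣                                          ≡⟨ ∣∣≡∑ A ⟩
      ∑ₚ (λ Y → ⟦ A Y ⟧)                             ≡⟨ ∑-cong joins allPoints ⟨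
      ∑ₚ (λ Y → ⟦ A Y ⟧ * commonLines Y X)           ≡⟨ ∑-meet-through A X ⟨
      ∑ₚ (λ ℓ → ⟦ inc X ℓ ⟧ * meet A ℓ)
        ≤⟨ ∑-mono-≤ (λ ℓ → *-monoʳ-≤ ⟦ inc X ℓ ⟧ (split (meet A ℓ) (meet≤2 ℓ))) allPoints ⟩
      ∑ₚ (λ ℓ → ⟦ inc X ℓ ⟧ * (⟦ meet A ℓ ≡ᵇ 1 ⟧ + 2 * ⟦ secant A ℓ ⟧))
        ≡⟨ ∑-cong (λ ℓ → distrib ⟦ inc X ℓ ⟧ ⟦ meet A ℓ ≡ᵇ 1 ⟧ ⟦ secant A ℓ ⟧) allPoints ⟩
      ∑ₚ (λ ℓ → ⟦ inc X ℓ ⟧ * ⟦ meet A ℓ ≡ᵇ 1 ⟧ + 2 * (⟦ inc X ℓ ⟧ * ⟦ secant A ℓ ⟧))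
        ≡⟨ trans (∑-+ _ _ allPoints) (cong₂ _+_ (sym (tangentsThrough≡∑ A X))
             (trans (∑-*ˡ 2 _ allPoints) (cong (2 *_) (sym (secantsThrough≡∑ A X))))) ⟩
      tangentsThrough A X + 2 * secantsThrough A X  ∎
      where
      open ≤-Reasoning
      joins : ∀ Y → ⟦ A Y ⟧ * commonLines Y X ≡ ⟦ A Y ⟧
      joins Y = ⟦⟧*-when (A Y) λ Y∈A → commonLines-≢ Y X λ { refl → true≢false (trans (sym Y∈A) X∉A) }
      split : ∀ m → m ≤ 2 → m ≤ ⟦ m ≡ᵇ 1 ⟧ + 2 * ⟦ m ≡ᵇ 2 ⟧
      split zero _ = z≤n
      split (suc zero) _ = ≤-refl
      split (suc (suc zero)) _ = ≤-refl
      split (suc (suc (suc m))) (s≤s (s≤s ()))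
      distrib : ∀ a b c → a * (b + 2 * c) ≡ a * b + 2 * (a * c)
      distrib = solve-∀

    1≤secantsThrough : ∀ P ℓ {Q R} → Q ≢ R → Q ∈ A → R ∈ A →
                       inc Q ℓ ≡ true → inc R ℓ ≡ true → inc P ℓ ≡ true → 1 ≤ secantsThrough A P
    1≤secantsThrough P ℓ {Q} {R} Q≢R Q∈A R∈A Q∈ℓ R∈ℓ P∈ℓ = subst (_≤ secantsThrough A P)
      (cong₂ (λ a b → ⟦ a ⟧ * ⟦ b ⟧) P∈ℓ (secant-through ℓ Q≢R Q∈A R∈A Q∈ℓ R∈ℓ))
      (subst (⟦ inc P ℓ ⟧ * ⟦ secant A ℓ ⟧ ≤_) (sym (secantsThrough≡∑ A P))
        (term≤∑ₚ ℓ (λ ℓ → ⟦ inc P ℓ ⟧ * ⟦ secant A ℓ ⟧)))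

    ∪｛｝-arc : ∀ P → ¬ 1 ≤ secantsThrough A P → IsArc (A ∪｛ P ｝)
    ∪｛｝-arc P no-secant X Y Z X∈ Y∈ Z∈ X≢Y X≢Z Y≢Z (ℓ , X∈ℓ , Y∈ℓ , Z∈ℓ)
      with ∈-∪｛｝ A X∈ | ∈-∪｛｝ A Y∈ | ∈-∪｛｝ A Z∈
    ... | inj₁ X∈A | inj₁ Y∈A | inj₁ Z∈A = arc X Y Z X∈A Y∈A Z∈A X≢Y X≢Z Y≢Z (ℓ , X∈ℓ , Y∈ℓ , Z∈ℓ)
    ... | inj₂ refl | inj₁ Y∈A | inj₁ Z∈A = no-secant (1≤secantsThrough X ℓ Y≢Z Y∈A Z∈A Y∈ℓ Z∈ℓ X∈ℓ)
    ... | inj₁ X∈A | inj₂ refl | inj₁ Z∈A = no-secant (1≤secantsThrough Y ℓ X≢Z X∈A Z∈A X∈ℓ Z∈ℓ Y∈ℓ)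
    ... | inj₁ X∈A | inj₁ Y∈A | inj₂ refl = no-secant (1≤secantsThrough Z ℓ X≢Y X∈A Y∈A X∈ℓ Y∈ℓ Z∈ℓ)
    ... | inj₂ refl | inj₂ refl | _ = X≢Y refl
    ... | inj₂ refl | inj₁ _ | inj₂ refl = X≢Z refl
    ... | inj₁ _ | inj₂ refl | inj₂ refl = Y≢Z refl

  2n≤[1+n]n : ∀ n → 2 * n ≤ suc n * n
  2n≤[1+n]n zero = z≤n
  2n≤[1+n]n (suc n) = *-monoˡ-≤ (suc n) {2} {suc (suc n)} (s≤s (s≤s z≤n))

  ∈-∖ : ∀ {S A X} → (S ∖ A) X ≡ true → (X ∈ S) × (X ∉ A)
  ∈-∖ {S} {A} {X} X∈S∖A with S X | A X
  ... | true | false = refl , refl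

  module _ {S A : PointSet} (A⊆S : A ⊆ S) (arc : IsArc A) where

    secant-meet : ∀ ℓ → secant A ℓ ≡ true → meet S ℓ ≡ 2 + meet (S ∖ A) ℓ
    secant-meet ℓ sec = trans (meet-∖ A⊆S ℓ) (cong (_+ meet (S ∖ A) ℓ) (≡ᵇ⇒≡ (meet A ℓ) 2 sec))

    -- A secant meeting S ∖ A in n points contributes (n + 1) n ≥ 2 n to the excess.
    2∑secants≤excess : 2 * ∑ₚ (λ X → ⟦ (S ∖ A) X ⟧ * secantsThrough A X) ≤ excess S
    2∑secants≤excess = begin
      2 * ∑ₚ (λ X → ⟦ (S ∖ A) X ⟧ * secantsThrough A X)   ≡⟨ cong (2 *_) (∑secantsThrough A (S ∖ A)) ⟩
      2 * ∑ₚ (λ ℓ → ⟦ secant A ℓ ⟧ * meet (S ∖ A) ℓ)       ≡⟨ ∑-*ˡ 2 _ allPoints ⟨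
      ∑ₚ (λ ℓ → 2 * (⟦ secant A ℓ ⟧ * meet (S ∖ A) ℓ))     ≤⟨ ∑-mono-≤ on-line allPoints ⟩
      excess S                                              ∎
      where
      open ≤-Reasoning
      on-line : ∀ ℓ → 2 * (⟦ secant A ℓ ⟧ * meet (S ∖ A) ℓ) ≤ (meet S ℓ ∸ 1) * (meet S ℓ ∸ 2)
      on-line ℓ = by-cases (secant A ℓ) refl
        where
        by-cases : ∀ b → secant A ℓ ≡ b → 2 * (⟦ b ⟧ * meet (S ∖ A) ℓ) ≤ (meet S ℓ ∸ 1) * (meet S ℓ ∸ 2)
        by-cases false _ = z≤n
        by-cases true sec = subst (λ m → 2 * (1 * meet (S ∖ A) ℓ) ≤ (m ∸ 1) * (m ∸ 2)) (sym (secant-meet ℓ sec))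
          (subst (λ k → 2 * k ≤ suc n * n) (sym (*-identityˡ n)) (2n≤[1+n]n n))
          where n = meet (S ∖ A) ℓ

    tangent-bound : ∀ μ → (∀ P → P ∈ S → P ∉ A → tangentsThrough A P ≤ μ) →
                    ∣ S ∖ A ∣ * (∣ A ∣ ∸ μ) ≤ excess S
    tangent-bound μ few-tangents = begin
      ∣ S ∖ A ∣ * (∣ A ∣ ∸ μ)                                 ≡⟨ *-comm ∣ S ∖ A ∣ (∣ A ∣ ∸ μ) ⟩
      (∣ A ∣ ∸ μ) * ∣ S ∖ A ∣                                 ≡⟨ cong ((∣ A ∣ ∸ μ) *_) (∣∣≡∑ (S ∖ A)) ⟩
      (∣ A ∣ ∸ μ) * ∑ₚ (λ X → ⟦ (S ∖ A) X ⟧)                  ≡⟨ ∑-*ˡ (∣ A ∣ ∸ μ) _ allPoints ⟨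
      ∑ₚ (λ X → (∣ A ∣ ∸ μ) * ⟦ (S ∖ A) X ⟧)                  ≤⟨ ∑-mono-≤ per-point allPoints ⟩
      ∑ₚ (λ X → 2 * (⟦ (S ∖ A) X ⟧ * secantsThrough A X))     ≡⟨ ∑-*ˡ 2 _ allPoints ⟩
      2 * ∑ₚ (λ X → ⟦ (S ∖ A) X ⟧ * secantsThrough A X)       ≤⟨ 2∑secants≤excess ⟩
      excess S                                                ∎
      where
      open ≤-Reasoning
      ∣A∣∸μ≤2secants : ∀ X → X ∈ S → X ∉ A → ∣ A ∣ ∸ μ ≤ 2 * secantsThrough A X
      ∣A∣∸μ≤2secants X X∈S X∉A = begin
        ∣ A ∣ ∸ μ                                     ≤⟨ ∸-monoˡ-≤ μ (∣A∣≤tangents+2secants arc X X∉A) ⟩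
        tangentsThrough A X + 2 * secantsThrough A X ∸ μ ≤⟨ ∸-monoˡ-≤ μ (+-monoˡ-≤ _ (few-tangents X X∈S X∉A)) ⟩
        μ + 2 * secantsThrough A X ∸ μ                ≡⟨ m+n∸m≡n μ _ ⟩
        2 * secantsThrough A X                        ∎
      per-point : ∀ X → (∣ A ∣ ∸ μ) * ⟦ (S ∖ A) X ⟧ ≤ 2 * (⟦ (S ∖ A) X ⟧ * secantsThrough A X)
      per-point X = subst₂ _≤_ (*-comm ⟦ (S ∖ A) X ⟧ (∣ A ∣ ∸ μ)) (swap ⟦ (S ∖ A) X ⟧ (secantsThrough A X))
        (⟦⟧*-monoʳ-≤ ((S ∖ A) X) λ X∈S∖A →
          let X∈S , X∉A = ∈-∖ {S} {A} X∈S∖A in ∣A∣∸μ≤2secants X X∈S X∉A)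
        where
        swap : ∀ b s → b * (2 * s) ≡ 2 * (b * s)
        swap = solve-∀

  proArcPoints : PointSet → PointSet → PointSet
  proArcPoints S A X = (S ∖ A) X ∧ (secantsThrough A X ≡ᵇ 1)

  ∈proArcPoints : ∀ {S A X} → proArcPoints S A X ≡ true → IsProArcPoint S A X
  ∈proArcPoints {S} {A} {X} X∈ =
    let X∈S∖A , one-secant = ∧-elim {(S ∖ A) X} X∈
        X∈S , X∉A = ∈-∖ {S} {A} X∈S∖A
    in X∈S , X∉A , ≡ᵇ⇒≡ (secantsThrough A X) 1 one-secant

  4≤2s+2[s≡1]s : ∀ s → 1 ≤ s → 4 ≤ 2 * s + 2 * (⟦ s ≡ᵇ 1 ⟧ * s)
  4≤2s+2[s≡1]s (suc zero) _ = ≤-refl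
  4≤2s+2[s≡1]s (suc (suc s)) _ = ≤-trans (*-monoʳ-≤ 2 (s≤s (s≤s (z≤n {s})))) (m≤m+n _ _)

  2n+2m≤[1+n]n+2 : ∀ n m → m ≤ n → 2 * n + 2 * m ≤ suc n * n + 2
  2n+2m≤[1+n]n+2 n m m≤n = ≤-trans (+-monoʳ-≤ (2 * n) (*-monoʳ-≤ 2 m≤n)) (4n≤ n)
    where
    4n≤ : ∀ n → 2 * n + 2 * n ≤ suc n * n + 2
    4n≤ zero = z≤n
    4n≤ (suc zero) = ≤-refl
    4n≤ (suc (suc r)) = subst (2 * suc (suc r) + 2 * suc (suc r) ≤_) (expand r) (m≤m+n _ (r * r + r))
      where
      expand : ∀ r → 2 * suc (suc r) + 2 * suc (suc r) + (r * r + r) ≡ suc (suc (suc r)) * suc (suc r) + 2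
      expand = solve-∀

  meet-mono : ∀ {D E} → D ⊆ E → ∀ ℓ → meet D ℓ ≤ meet E ℓ
  meet-mono {D} {E} D⊆E ℓ = subst₂ _≤_ (sym (meet≡∑ D ℓ)) (sym (meet≡∑ E ℓ)) (∑-mono-≤ pointwise allPoints)
    where
    pointwise : ∀ X → ⟦ D X ∧ inc X ℓ ⟧ ≤ ⟦ E X ∧ inc X ℓ ⟧
    pointwise X with D X in X∈D
    ... | false = z≤n
    ... | true rewrite D⊆E X X∈D = ≤-refl

  module _ {S A B : PointSet} (maximal : IsSMaximalArc S A) (proArc : IsProArcSet S A B) where

    private
      A⊆S = proj₁ maximal
      arc = proj₁ (proj₂ maximal)
      PA = proArcPoints S A

    -- Otherwise P could be added to A.
    1≤secantsThrough-off : ∀ P → P ∈ S → P ∉ A → 1 ≤ secantsThrough A P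
    1≤secantsThrough-off P P∈S P∉A = decidable-stable (1 ≤? secantsThrough A P) λ no-secant →
      proj₂ (proj₂ maximal) P P∈S P∉A (∪｛｝-arc arc P no-secant)

    -- By the pro-arc property, a secant carrying a pro-arc point carries exactly one point of B.
    per-secant : ∀ ℓ → ⟦ secant A ℓ ⟧ * (2 * meet (S ∖ A) ℓ + 2 * meet PA ℓ) ≤
                       (meet S ℓ ∸ 1) * (meet S ℓ ∸ 2) + 2 * (⟦ secant A ℓ ⟧ * meet B ℓ)
    per-secant ℓ = by-secant (secant A ℓ) refl
      where
      n = meet (S ∖ A) ℓ
      by-pro-arc : ∀ m → meet PA ℓ ≡ m → secant A ℓ ≡ true → 2 * n + 2 * m ≤ suc n * n + 2 * (1 * meet B ℓ)
      by-pro-arc zero _ _ = ≤-trans (≤-reflexive (+-identityʳ (2 * n))) (≤-trans (2n≤[1+n]n n) (m≤m+n _ _))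
      by-pro-arc (suc m) PA∩ℓ≡m+1 sec =
        let Y , Y∈PA∩ℓ = ∑-witness (λ X → PA X ∧ inc X ℓ) allPoints
                           (subst (1 ≤_) (trans (sym PA∩ℓ≡m+1) (meet≡∑ PA ℓ)) (s≤s z≤n))
            Y∈PA , Y∈ℓ = ∧-elim Y∈PA∩ℓ
            one-in-B = proj₂ proArc ℓ (≡ᵇ⇒≡ (meet A ℓ) 2 sec) (Y , ∈proArcPoints {S} {A} Y∈PA , Y∈ℓ)
        in subst (λ b → 2 * n + 2 * suc m ≤ suc n * n + 2 * (1 * b)) (sym one-in-B)
             (2n+2m≤[1+n]n+2 n (suc m)
               (subst (_≤ n) PA∩ℓ≡m+1 (meet-mono (λ X X∈PA → proj₁ (∧-elim {(S ∖ A) X} X∈PA)) ℓ)))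
      by-secant : ∀ b → secant A ℓ ≡ b →
                  ⟦ b ⟧ * (2 * n + 2 * meet PA ℓ) ≤ (meet S ℓ ∸ 1) * (meet S ℓ ∸ 2) + 2 * (⟦ b ⟧ * meet B ℓ)
      by-secant false _ = z≤n
      by-secant true sec =
        subst (λ k → 1 * (2 * n + 2 * meet PA ℓ) ≤ (k ∸ 1) * (k ∸ 2) + 2 * (1 * meet B ℓ))
          (sym (secant-meet A⊆S arc ℓ sec))
          (subst (_≤ suc n * n + 2 * (1 * meet B ℓ)) (sym (*-identityˡ _)) (by-pro-arc (meet PA ℓ) refl sec))

    ∑secants-B≡∣B∣ : ∑ₚ (λ ℓ → ⟦ secant A ℓ ⟧ * meet B ℓ) ≡ ∣ B ∣
    ∑secants-B≡∣B∣ = begin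
      ∑ₚ (λ ℓ → ⟦ secant A ℓ ⟧ * meet B ℓ)       ≡⟨ ∑secantsThrough A B ⟨
      ∑ₚ (λ X → ⟦ B X ⟧ * secantsThrough A X)    ≡⟨ ∑-cong one-secant allPoints ⟩
      ∑ₚ (λ X → ⟦ B X ⟧)                         ≡⟨ ∣∣≡∑ B ⟨
      ∣ B ∣                                      ∎
      where
      open ≡-Reasoning
      one-secant : ∀ X → ⟦ B X ⟧ * secantsThrough A X ≡ ⟦ B X ⟧
      one-secant X = ⟦⟧*-when (B X) λ X∈B → proj₂ (proj₂ (proj₁ proArc X X∈B))

    pro-arc-bound : 4 * ∣ S ∖ A ∣ ≤ excess S + 2 * ∣ B ∣
    pro-arc-bound = begin
      4 * ∣ S ∖ A ∣
        ≡⟨ trans (cong (4 *_) (∣∣≡∑ (S ∖ A))) (sym (∑-*ˡ 4 _ allPoints)) ⟩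
      ∑ₚ (λ X → 4 * ⟦ (S ∖ A) X ⟧)
        ≤⟨ ∑-mono-≤ per-point allPoints ⟩
      ∑ₚ (λ X → 2 * (⟦ (S ∖ A) X ⟧ * secantsThrough A X) + 2 * (⟦ PA X ⟧ * secantsThrough A X))
        ≡⟨ trans (∑-+ _ _ allPoints) (cong₂ _+_ (∑-*ˡ 2 _ allPoints) (∑-*ˡ 2 _ allPoints)) ⟩
      2 * ∑ₚ (λ X → ⟦ (S ∖ A) X ⟧ * secantsThrough A X) + 2 * ∑ₚ (λ X → ⟦ PA X ⟧ * secantsThrough A X)
        ≡⟨ cong₂ (λ a b → 2 * a + 2 * b) (∑secantsThrough A (S ∖ A)) (∑secantsThrough A PA) ⟩
      2 * ∑ₚ (λ ℓ → ⟦ secant A ℓ ⟧ * meet (S ∖ A) ℓ) + 2 * ∑ₚ (λ ℓ → ⟦ secant A ℓ ⟧ * meet PA ℓ)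
        ≡⟨ trans (∑-+ _ _ allPoints) (cong₂ _+_ (∑-*ˡ 2 _ allPoints) (∑-*ˡ 2 _ allPoints)) ⟨
      ∑ₚ (λ ℓ → 2 * (⟦ secant A ℓ ⟧ * meet (S ∖ A) ℓ) + 2 * (⟦ secant A ℓ ⟧ * meet PA ℓ))
        ≡⟨ ∑-cong (λ ℓ → factor ⟦ secant A ℓ ⟧ (meet (S ∖ A) ℓ) (meet PA ℓ)) allPoints ⟩
      ∑ₚ (λ ℓ → ⟦ secant A ℓ ⟧ * (2 * meet (S ∖ A) ℓ + 2 * meet PA ℓ))
        ≤⟨ ∑-mono-≤ per-secant allPoints ⟩
      ∑ₚ (λ ℓ → (meet S ℓ ∸ 1) * (meet S ℓ ∸ 2) + 2 * (⟦ secant A ℓ ⟧ * meet B ℓ))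
        ≡⟨ trans (∑-+ _ _ allPoints) (cong (excess S +_) (∑-*ˡ 2 _ allPoints)) ⟩
      excess S + 2 * ∑ₚ (λ ℓ → ⟦ secant A ℓ ⟧ * meet B ℓ)
        ≡⟨ cong (λ t → excess S + 2 * t) ∑secants-B≡∣B∣ ⟩
      excess S + 2 * ∣ B ∣ ∎
      where
      open ≤-Reasoning
      factor : ∀ s a b → 2 * (s * a) + 2 * (s * b) ≡ s * (2 * a + 2 * b)
      factor = solve-∀
      reshape : ∀ b s e → b * (2 * s + 2 * (e * s)) ≡ 2 * (b * s) + 2 * ((b * e) * s)
      reshape = solve-∀
      -- A point of S ∖ A lies on a secant; if only on one, it is a pro-arc point.
      per-point : ∀ X → 4 * ⟦ (S ∖ A) X ⟧ ≤
                        2 * (⟦ (S ∖ A) X ⟧ * secantsThrough A X) + 2 * (⟦ PA X ⟧ * secantsThrough A X)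
      per-point X = subst₂ _≤_ (*-comm ⟦ (S ∖ A) X ⟧ 4)
        (trans (reshape ⟦ (S ∖ A) X ⟧ s ⟦ s ≡ᵇ 1 ⟧)
               (cong (λ t → 2 * (⟦ (S ∖ A) X ⟧ * s) + 2 * (t * s)) (sym (⟦∧⟧ ((S ∖ A) X) (s ≡ᵇ 1)))))
        (⟦⟧*-monoʳ-≤ ((S ∖ A) X) λ X∈S∖A →
          let X∈S , X∉A = ∈-∖ {S} {A} X∈S∖A in 4≤2s+2[s≡1]s s (1≤secantsThrough-off X X∈S X∉A))
        where s = secantsThrough A X

open import Data.Nat using (ℕ; _+_; _*_; _∸_; _≤_)
open import Data.Product using (_×_)
open import Relation.Binary.PropositionalEquality using (_≡_)

open import Data.Nat.Properties using (≤-trans; +-monoˡ-≤; +-monoʳ-≤; m+n∸m≡n)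
open import Data.Product using (_,_; proj₁; proj₂)
open import Relation.Binary.PropositionalEquality using (refl; sym; trans; cong; subst)
open import Data.Nat.Tactic.RingSolver using (solve-∀)

u+4[k+s]≤ : ∀ u e Q s b k → u + e ≤ Q → 4 * s ≤ e + 2 * b → u + 4 * (k + s) ≤ Q + 4 * k + 2 * b
u+4[k+s]≤ u e Q s b k u+e≤Q 4s≤e+2b = begin
  u + 4 * (k + s)         ≡⟨ shuffle u k s ⟩
  4 * k + (u + 4 * s)     ≤⟨ +-monoʳ-≤ (4 * k) (+-monoʳ-≤ u 4s≤e+2b) ⟩
  4 * k + (u + (e + 2 * b)) ≡⟨ shuffle′ k u e (2 * b) ⟩
  (u + e) + 4 * k + 2 * b ≤⟨ +-monoˡ-≤ (2 * b) (+-monoˡ-≤ (4 * k) u+e≤Q) ⟩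
  Q + 4 * k + 2 * b       ∎
  where
  open Data.Nat.Properties.≤-Reasoning
  shuffle : ∀ u k s → u + 4 * (k + s) ≡ 4 * k + (u + 4 * s)
  shuffle = solve-∀
  shuffle′ : ∀ k u e c → 4 * k + (u + (e + c)) ≡ u + e + 4 * k + c
  shuffle′ = solve-∀

lemma2p4 : (q : ℕ) (F : FiniteField q) →
    let open PG F in
    (S A B : PointSet) (k l : ℕ) →
    ∣ S ∣ ≡ q + 1 →
    IsSMaximalArc S A → ∣ A ∣ ≡ k →
    IsProArcSet S A B → ∣ B ∣ ≡ l → l ≤ (q + 1) ∸ k →
    ((μ : ℕ) → μ ≤ k → (∀ P → P ∈ S → P ∉ A → tangentsThrough A P ≤ μ) →
       2 * u₀ S + ((q + 1) ∸ k) * (k ∸ μ) ≤ q * (q ∸ 1))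
    × (2 * u₀ S + 4 * (q + 1) ≤ q * (q ∸ 1) + 4 * k + 2 * l)
lemma2p4 q F S A B _ _ ∣S∣≡q+1 maximal refl proArc refl _ = tangent-part , pro-arc-part
  where
  open PG F
  open DisjointLines F using (excess; u₀-bound)
  open Arcs F using (_∖_; ∣∣-∖; tangent-bound; pro-arc-bound)

  q+1≡∣A∣+∣S∖A∣ : q + 1 ≡ ∣ A ∣ + ∣ S ∖ A ∣
  q+1≡∣A∣+∣S∖A∣ = trans (sym ∣S∣≡q+1) (∣∣-∖ (proj₁ maximal))

  ∣S∖A∣≡q+1∸∣A∣ : ∣ S ∖ A ∣ ≡ (q + 1) ∸ ∣ A ∣
  ∣S∖A∣≡q+1∸∣A∣ = sym (trans (cong (_∸ ∣ A ∣) q+1≡∣A∣+∣S∖A∣) (m+n∸m≡n ∣ A ∣ ∣ S ∖ A ∣))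

  tangent-part : (μ : ℕ) → μ ≤ ∣ A ∣ → (∀ P → P ∈ S → P ∉ A → tangentsThrough A P ≤ μ) →
                 2 * u₀ S + ((q + 1) ∸ ∣ A ∣) * (∣ A ∣ ∸ μ) ≤ q * (q ∸ 1)
  tangent-part μ _ few-tangents = subst (λ n → 2 * u₀ S + n * (∣ A ∣ ∸ μ) ≤ q * (q ∸ 1)) ∣S∖A∣≡q+1∸∣A∣
    (≤-trans (+-monoʳ-≤ (2 * u₀ S) (tangent-bound (proj₁ maximal) (proj₁ (proj₂ maximal)) μ few-tangents))
             (u₀-bound S ∣S∣≡q+1))

  pro-arc-part : 2 * u₀ S + 4 * (q + 1) ≤ q * (q ∸ 1) + 4 * ∣ A ∣ + 2 * ∣ B ∣
  pro-arc-part = subst (λ n → 2 * u₀ S + 4 * n ≤ q * (q ∸ 1) + 4 * ∣ A ∣ + 2 * ∣ B ∣) (sym q+1≡∣A∣+∣S∖A∣)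
    (u+4[k+s]≤ (2 * u₀ S) (excess S) (q * (q ∸ 1)) (∣ S ∖ A ∣) (∣ B ∣) (∣ A ∣)
      (u₀-bound S ∣S∣≡q+1) (pro-arc-bound maximal proArc))
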